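{- The $(-\varepsilon,I_\bullet,J_\circ)$-increasing flip graph and the $(\overline{\varepsilon},\overline{J_\circ},\overline{I_\bullet})$-increasing flip graph are both isomorphic to the opposite (all arcs reversed) of the $(\varepsilon,I_\bullet,J_\circ)$-increasing flip graph, where $(-\varepsilon)_k=-\varepsilon_k$, $\overline{\varepsilon}_k=\varepsilon_{n+1-k}$ for $k\in\{1,\dots,n\}$, $\overline{J_\circ}=\{(n+1-j)_\bullet: j_\circ\in J_\circ\}$ and $\overline{I_\bullet}=\{(n+1-i)_\circ: i_\bullet\in I_\bullet\}$.
   Context: Fix an integer $n\ge1$. For a signature $\varepsilon\in\{+,-\}^n$: black vertices are $0_\bullet,\dots,n_\bullet$, white vertices $1_\circ,\dots,(n+1)_\circ$, compared through their integer indices. Let $P_\varepsilon$ be a convex $(2n+2)$-gon in $\mathbb{R}^2$ whose vertices, in strictly increasing $x$-order, are $0_\bullet,1_\circ,1_\bullet,\dots,n_\circ,n_\bullet,(n+1)_\circ$, with $k_\circ,k_\bullet$ strictly above the line through $0_\bullet$ and $(n+1)_\circ$ if $\varepsilon_k=+$ and strictly below if $\varepsilon_k=-$ ($1\le k\le n$). For $I_\bullet\subseteq\{0_\bullet,\dots,n_\bullet\}$, $J_\circ\subseteq\{1_\circ,\dots,(n+1)_\circ\}$ nonempty with $\min(I_\bullet)<\min(J_\circ)$ and $\max(I_\bullet)<\max(J_\circ)$, let $G$ be the geometric graph on $I_\bullet\cup J_\circ$ with a straight edge $(i_\bullet,j_\circ)$ whenever $i<j$; two edges cross if they meet at a point interior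 to both. An $(\varepsilon,I_\bullet,J_\circ)$-tree is an inclusion-maximal set of pairwise non-crossing edges of $G$. Trees $T,T'$ are related by a flip if $T\setminus\{(i_\bullet,j_\circ)\}=T'\setminus\{(i'_\bullet,j'_\circ)\}$ for some $(i_\bullet,j_\circ)\in T$, $(i'_\bullet,j'_\circ)\in T'$, $T\ne T'$; this flip from $T$ to $T'$ is increasing if the slope of $(i_\bullet,j_\circ)$ is smaller than that of $(i'_\bullet,j'_\circ)$. The $(\varepsilon,I_\bullet,J_\circ)$-increasing flip graph is the directed graph on $(\varepsilon,I_\bullet,J_\circ)$-trees with an arc $T\to T'$ for each increasing flip from $T$ to $T'$.
   Formalization: The vertices of each polygon $P_\varepsilon$, for $\varepsilon$, $-\varepsilon$ and $\overline{\varepsilon}$ alike, have rational coordinates, lying in ℚ^2 instead of $\mathbb{R}^2$. -}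

module Defs where

open import Data.Nat as ℕ using (ℕ; zero; suc)
open import Data.Fin as Fin using (Fin; toℕ; inject₁; fromℕ; opposite)
open import Data.Fin.Subset using (Subset; _∈_; Nonempty)
open import Data.Bool using (Bool; true; false)
open import Data.Vec using (Vec; lookup; tabulate; updateAt; _[_]≔_)
open import Data.Rational using (ℚ; 0ℚ; 1ℚ; _+_; _*_; _-_; _<_; _≤_)
open import Data.Product using (_×_; _,_; proj₁; proj₂; ∃; Σ-syntax; ∃-syntax)
open import Data.Sum using (_⊎_)
open import Relation.Binary.PropositionalEquality using (_≡_; _≢_)
open import Relation.Nullary using (¬_)

-- Signs and signatures.  A signature ε ∈ {+,-}^n is a map Fin n → Sign,
-- where the index k : Fin n stands for the position toℕ k + 1 ∈ {1..n}.

data Sign : Set where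
  plus minus : Sign

neg : Sign → Sign
neg plus  = minus
neg minus = plus

Signature : ℕ → Set
Signature n = Fin n → Sign

negSig : ∀ {n} → Signature n → Signature n
negSig ε k = neg (ε k)

-- ε̄_k = ε_{n+1-k}: position p = toℕ k + 1 maps to toℕ (opposite k) + 1 = n + 1 - p
barSig : ∀ {n} → Signature n → Signature n
barSig ε k = ε (opposite k)

-- Black vertices i_• (i = 0..n) are encoded by b : Fin (suc n)
-- with integer index toℕ b.  White vertices j_∘ (j = 1..n+1) are encoded
-- by w : Fin (suc n) with integer index toℕ w + 1.

bIdx : ∀ {n} → Fin (suc n) → ℕ
bIdx b = toℕ b

wIdx : ∀ {n} → Fin (suc n) → ℕ
wIdx w = suc (toℕ w)

-- Vertex type: inj₁ = black, inj₂ = white.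
Vertex : ℕ → Set
Vertex n = Fin (suc n) ⊎ Fin (suc n)

Point : Set
Point = ℚ × ℚ

xc : Point → ℚ
xc = proj₁

yc : Point → ℚ
yc = proj₂

-- orientation determinant: > 0 iff r is strictly left of the directed line p→q
orient : Point → Point → Point → ℚ
orient p q r = ((xc q - xc p) * (yc r - yc p)) - ((yc q - yc p) * (xc r - xc p))

InHull3 : Point → Point → Point → Point → Set
InHull3 a b c p =
  ∃[ l₁ ] ∃[ l₂ ] ∃[ l₃ ]
    (0ℚ ≤ l₁) × (0ℚ ≤ l₂) × (0ℚ ≤ l₃) × ((l₁ + l₂) + l₃ ≡ 1ℚ) ×
    (xc p ≡ ((l₁ * xc a) + (l₂ * xc b)) + (l₃ * xc c)) ×
    (yc p ≡ ((l₁ * yc a) + (l₂ * yc b)) + (l₃ * yc c))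

SegCross : Point → Point → Point → Point → Set
SegCross a b c d =
  ∃[ t ] ∃[ s ]
    (0ℚ < t) × (t < 1ℚ) × (0ℚ < s) × (s < 1ℚ) ×
    (xc a + (t * (xc b - xc a)) ≡ xc c + (s * (xc d - xc c))) ×
    (yc a + (t * (yc b - yc a)) ≡ yc c + (s * (yc d - yc c)))

SideOK : Sign → Point → Point → Point → Set
SideOK plus  a b p = 0ℚ < orient a b p
SideOK minus a b p = orient a b p < 0ℚ

vpos : ∀ {n} → (Fin (suc n) → Point) → (Fin (suc n) → Point) → Vertex n → Point
vpos bl wh (_⊎_.inj₁ b) = bl b
vpos bl wh (_⊎_.inj₂ w) = wh w

record Polygon (n : ℕ) (ε : Signature n) : Set where
  field
    black : Fin (suc n) → Point
    white : Fin (suc n) → Point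
    -- strictly increasing x-order  0_•, 1_∘, 1_•, …, n_•, (n+1)_∘
    xorder₁ : ∀ (k : Fin (suc n)) → xc (black k) < xc (white k)
    xorder₂ : ∀ (k : Fin n) → xc (white (inject₁ k)) < xc (black (Fin.suc k))
    sideB : ∀ (k : Fin n) → SideOK (ε k) (black Fin.zero) (white (fromℕ n)) (black (Fin.suc k))
    sideW : ∀ (k : Fin n) → SideOK (ε k) (black Fin.zero) (white (fromℕ n)) (white (inject₁ k))
    -- the 2n+2 points are in strictly convex position: no vertex lies in the
    -- convex hull of three other vertices (Carathéodory form)
    convex : ∀ (a b c d : Vertex n) → a ≢ b → a ≢ c → a ≢ d → b ≢ c → b ≢ d → c ≢ d →
             ¬ InHull3 (vpos black white a) (vpos black white b) (vpos black white c) (vpos black white d)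

MinLess : ∀ {n} → Subset (suc n) → Subset (suc n) → Set
MinLess I J = ∃[ i ] (i ∈ I) × (∀ j → j ∈ J → bIdx i ℕ.< wIdx j)

MaxLess : ∀ {n} → Subset (suc n) → Subset (suc n) → Set
MaxLess I J = ∃[ j ] (j ∈ J) × (∀ i → i ∈ I → bIdx i ℕ.< wIdx j)

-- J̄ = {(n+1-j)_• : j_∘ ∈ J}  and  Ī = {(n+1-i)_∘ : i_• ∈ I};
-- in the encoding both are  S ↦ (k ↦ S(opposite k)).
barSet : ∀ {n} → Subset (suc n) → Subset (suc n)
barSet S = tabulate (λ k → lookup S (opposite k))

-- Edge sets: an edge (i_•, j_∘) is a pair (b, w); a set of edges is a
-- Boolean matrix indexed by black × white.

EdgeSet : ℕ → Set
EdgeSet n = Vec (Vec Bool (suc n)) (suc n)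

_∋ₑ_,_ : ∀ {n} → EdgeSet n → Fin (suc n) → Fin (suc n) → Set
E ∋ₑ b , w = lookup (lookup E b) w ≡ true

_⊆ₑ_ : ∀ {n} → EdgeSet n → EdgeSet n → Set
E ⊆ₑ E' = ∀ b w → E ∋ₑ b , w → E' ∋ₑ b , w

removeₑ : ∀ {n} → EdgeSet n → Fin (suc n) → Fin (suc n) → EdgeSet n
removeₑ E b w = updateAt E b (λ row → row [ w ]≔ false)

IsEdgeG : ∀ {n} → Subset (suc n) → Subset (suc n) → Fin (suc n) → Fin (suc n) → Set
IsEdgeG I J b w = (b ∈ I) × (w ∈ J) × (bIdx b ℕ.< wIdx w)

module _ {n : ℕ} {ε : Signature n} (P : Polygon n ε) (I J : Subset (suc n)) where
  open Polygon P

  Cross : Fin (suc n) → Fin (suc n) → Fin (suc n) → Fin (suc n) → Set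
  Cross b w b' w' = SegCross (black b) (white w) (black b') (white w')

  NonCrossingSet : EdgeSet n → Set
  NonCrossingSet E =
    (∀ b w → E ∋ₑ b , w → IsEdgeG I J b w) ×
    (∀ b w b' w' → E ∋ₑ b , w → E ∋ₑ b' , w' → (b , w) ≢ (b' , w') → ¬ Cross b w b' w')

  IsTree : EdgeSet n → Set
  IsTree E = NonCrossingSet E × (∀ E' → E ⊆ₑ E' → NonCrossingSet E' → E' ⊆ₑ E)

  -- slope(b,w) < slope(b',w'); the x-increments are positive, so this is
  -- the comparison of  Δy/Δx  written with cleared denominators
  SlopeLess : Fin (suc n) → Fin (suc n) → Fin (suc n) → Fin (suc n) → Set
  SlopeLess b w b' w' =
    ((yc (white w) - yc (black b)) * (xc (white w') - xc (black b')))
      < ((yc (white w') - yc (black b')) * (xc (white w) - xc (black b)))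

  IncFlip : EdgeSet n → EdgeSet n → Set
  IncFlip T T' =
    ∃[ b ] ∃[ w ] ∃[ b' ] ∃[ w' ]
      (T ∋ₑ b , w) × (T' ∋ₑ b' , w') ×
      (removeₑ T b w ≡ removeₑ T' b' w') × (T ≢ T') ×
      SlopeLess b w b' w'

record DiGraph (n : ℕ) : Set₁ where
  field
    Vtx : EdgeSet n → Set
    Arc : EdgeSet n → EdgeSet n → Set

IncFlipGraph : ∀ {n} {ε : Signature n} → Polygon n ε → Subset (suc n) → Subset (suc n) → DiGraph n
IncFlipGraph P I J = record { Vtx = IsTree P I J ; Arc = IncFlip P I J }

opG : ∀ {n} → DiGraph n → DiGraph n
opG G = record { Vtx = DiGraph.Vtx G ; Arc = λ T T' → DiGraph.Arc G T' T }

record DiIso {n : ℕ} (G H : DiGraph n) : Set where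
  open DiGraph
  field
    to   : EdgeSet n → EdgeSet n
    from : EdgeSet n → EdgeSet n
    to-vtx   : ∀ T → Vtx G T → Vtx H (to T)
    from-vtx : ∀ T → Vtx H T → Vtx G (from T)
    from∘to  : ∀ T → Vtx G T → from (to T) ≡ T
    to∘from  : ∀ T → Vtx H T → to (from T) ≡ T
    arc-to   : ∀ T T' → Vtx G T → Vtx G T' → Arc G T T' → Arc H (to T) (to T')
    arc-from : ∀ T T' → Vtx G T → Vtx G T' → Arc H (to T) (to T') → Arc G T T'

-- All that the increasing flip graph sees of the polygon is the orientation of vertex triples:
-- two edges cross iff each separates the endpoints of the other, and for crossing edges the
-- slope order is the sign of one such orientation.  By convexity and the x-order, a vertex j
-- between vertices i < k lies above the chord ik exactly when ε_j = +.  Hence every orientation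
-- in P_{-ε} is the reverse of the corresponding one in P_ε, and so is every orientation in P_ε̄
-- after renaming k_• ↦ (n+1-k)_∘ and k_∘ ↦ (n+1-k)_•.  Reversing all orientations keeps the
-- crossing pairs and reverses the slope order of crossing edges, and the two edges exchanged by
-- a flip always cross; so relabelling edge sets (trivially, resp. by the renaming) maps trees to
-- trees and reverses every increasing flip.

module Submission where

open import Data.Bool using (Bool; true; false)
open import Data.Empty using (⊥; ⊥-elim)
open import Data.Fin as Fin using (Fin; toℕ; inject₁; fromℕ; opposite)
import Data.Fin.Properties as Finₚ
open import Data.Fin.Subset using (Subset; _∈_; Nonempty)
open import Data.Nat as ℕ using (ℕ; zero; suc; z≤n; s≤s; _∸_)
import Data.Nat.Properties as ℕₚ
open import Data.Nat.Tactic.RingSolver using (solve-∀)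
open import Data.Product using (∃; _×_; _,_; proj₁; proj₂)
import Data.Product.Properties as Productₚ
open import Data.Rational
  using (ℚ; 0ℚ; 1ℚ; _+_; _*_; _-_; -_; _<_; _≤_; _<?_; 1/_; positive; negative; nonNegative; nonPositive; ≢-nonZero)
open import Data.Rational.Properties
open import Data.Rational.Solver using (module +-*-Solver)
open import Data.Sum using (_⊎_; inj₁; inj₂; [_,_])
open import Data.Vec using (Vec; lookup; tabulate; updateAt; _[_]≔_)
import Data.Vec.Properties as Vecₚ
open import Relation.Binary.Definitions using (tri<; tri≈; tri>)
open import Relation.Binary.PropositionalEquality hiding ([_])
open import Relation.Nullary using (¬_; Dec; yes; no)
open import Defs
open +-*-Solver

p<q⇒0<q-p : ∀ {p q} → p < q → 0ℚ < q - p
p<q⇒0<q-p {p} {q} h = subst (_< q - p) (+-inverseʳ p) (+-monoˡ-< (- p) h)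

0<q-p⇒p<q : ∀ {p q} → 0ℚ < q - p → p < q
0<q-p⇒p<q {p} {q} h =
  subst₂ _<_ (+-identityˡ p) (solve 2 (λ q p → (q :- p) :+ p := q) refl q p) (+-monoˡ-< p h)

p≤q⇒0≤q-p : ∀ {p q} → p ≤ q → 0ℚ ≤ q - p
p≤q⇒0≤q-p {p} {q} h = subst (_≤ q - p) (+-inverseʳ p) (+-monoˡ-≤ (- p) h)

p<q⇒p-q<0 : ∀ {p q} → p < q → p - q < 0ℚ
p<q⇒p-q<0 {p} {q} h =
  subst (_< 0ℚ) (solve 2 (λ p q → :- (q :- p) := p :- q) refl p q) (neg-antimono-< (p<q⇒0<q-p h))

pos*pos>0 : ∀ {p q} → 0ℚ < p → 0ℚ < q → 0ℚ < p * q
pos*pos>0 {p} {q} hp hq = positive⁻¹ _ {{pos*pos⇒pos p {{positive hp}} q {{positive hq}}}}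

neg*neg>0 : ∀ {p q} → p < 0ℚ → q < 0ℚ → 0ℚ < p * q
neg*neg>0 {p} {q} hp hq = positive⁻¹ _ {{neg*neg⇒pos p {{negative hp}} q {{negative hq}}}}

pos*neg<0 : ∀ {p q} → 0ℚ < p → q < 0ℚ → p * q < 0ℚ
pos*neg<0 {p} {q} hp hq = negative⁻¹ _ {{pos*neg⇒neg p {{positive hp}} q {{negative hq}}}}

neg*pos<0 : ∀ {p q} → p < 0ℚ → 0ℚ < q → p * q < 0ℚ
neg*pos<0 {p} {q} hp hq = negative⁻¹ _ {{neg*pos⇒neg p {{negative hp}} q {{positive hq}}}}

nonNeg*nonNeg≥0 : ∀ {p q} → 0ℚ ≤ p → 0ℚ ≤ q → 0ℚ ≤ p * q
nonNeg*nonNeg≥0 {p} {q} hp hq =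
  nonNegative⁻¹ _ {{nonNeg*nonNeg⇒nonNeg p {{nonNegative hp}} q {{nonNegative hq}}}}

nonNeg*nonPos≤0 : ∀ {p q} → 0ℚ ≤ p → q ≤ 0ℚ → p * q ≤ 0ℚ
nonNeg*nonPos≤0 {p} {q} hp hq =
  nonPositive⁻¹ _ {{nonNeg*nonPos⇒nonPos p {{nonNegative hp}} q {{nonPositive hq}}}}

neg-involutive : ∀ p → - (- p) ≡ p
neg-involutive p = solve 1 (λ p → :- (:- p) := p) refl p

0<neg⇒<0 : ∀ {p} → 0ℚ < - p → p < 0ℚ
0<neg⇒<0 {p} h = subst (_< 0ℚ) (neg-involutive p) (neg-antimono-< h)

<⇒≱ : ∀ {p q} → p < q → ¬ (q ≤ p)
<⇒≱ h h' = <-irrefl refl (<-≤-trans h h')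

≤0-of-neg≥0 : ∀ {p q} → p ≡ - q → 0ℚ ≤ q → p ≤ 0ℚ
≤0-of-neg≥0 refl h = neg-antimono-≤ h

≥0-of-neg≤0 : ∀ {p q} → p ≡ - q → q ≤ 0ℚ → 0ℚ ≤ p
≥0-of-neg≤0 refl h = neg-antimono-≤ h

pos-by-contradiction : ∀ {p} → ¬ (p ≤ 0ℚ) → 0ℚ < p
pos-by-contradiction {p} h with 0ℚ <? p
... | yes 0<p = 0<p
... | no 0≮p = ⊥-elim (h (≮⇒≥ 0≮p))

weighted-sum-nonpos : ∀ {c X a₁ y₁ a₂ y₂ a₃ y₃} → 0ℚ < c → c * X ≡ (a₁ * y₁ + a₂ * y₂) + a₃ * y₃ →
  0ℚ ≤ a₁ → y₁ ≤ 0ℚ → 0ℚ ≤ a₂ → y₂ ≤ 0ℚ → 0ℚ ≤ a₃ → y₃ ≤ 0ℚ → X ≤ 0ℚ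
weighted-sum-nonpos c>0 eq a₁≥0 y₁≤0 a₂≥0 y₂≤0 a₃≥0 y₃≤0 = ≮⇒≥ λ X>0 →
  <⇒≱ (pos*pos>0 c>0 X>0)
      (subst (_≤ 0ℚ) (sym eq) (+-mono-≤ (+-mono-≤ (nonNeg*nonPos≤0 a₁≥0 y₁≤0) (nonNeg*nonPos≤0 a₂≥0 y₂≤0))
                                        (nonNeg*nonPos≤0 a₃≥0 y₃≤0)))

OppositeSigns : ℚ → ℚ → Set
OppositeSigns x y = (0ℚ < x × y < 0ℚ) ⊎ (x < 0ℚ × 0ℚ < y)

OppositeSigns-sym : ∀ {x y} → OppositeSigns x y → OppositeSigns y x
OppositeSigns-sym (inj₁ (x>0 , y<0)) = inj₂ (y<0 , x>0)
OppositeSigns-sym (inj₂ (x<0 , y>0)) = inj₁ (y>0 , x<0)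

OppositeSigns-neg : ∀ {x y} → OppositeSigns x y → OppositeSigns (- x) (- y)
OppositeSigns-neg (inj₁ (x>0 , y<0)) = inj₂ (neg-antimono-< x>0 , neg-antimono-< y<0)
OppositeSigns-neg (inj₂ (x<0 , y>0)) = inj₁ (neg-antimono-< x<0 , neg-antimono-< y>0)

OppositeSigns⇒≢ : ∀ {x y} → OppositeSigns x y → x - y ≢ 0ℚ
OppositeSigns⇒≢ (inj₁ (x>0 , y<0)) eq = <⇒≢ (p<q⇒0<q-p (<-trans y<0 x>0)) (sym eq)
OppositeSigns⇒≢ (inj₂ (x<0 , y>0)) eq = <⇒≢ (p<q⇒p-q<0 (<-trans x<0 y>0)) eq

oppositeSigns? : ∀ x y → Dec (OppositeSigns x y)
oppositeSigns? x y with 0ℚ <? x | y <? 0ℚ | x <? 0ℚ | 0ℚ <? y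
... | yes a | yes b | _     | _     = yes (inj₁ (a , b))
... | _     | _     | yes c | yes d = yes (inj₂ (c , d))
... | no a  | _     | no c  | _     = no λ { (inj₁ (a' , _)) → a a' ; (inj₂ (c' , _)) → c c' }
... | no a  | _     | yes c | no d  = no λ { (inj₁ (a' , _)) → a a' ; (inj₂ (_ , d')) → d d' }
... | yes a | no b  | no c  | _     = no λ { (inj₁ (_ , b')) → b b' ; (inj₂ (c' , _)) → c c' }
... | yes a | no b  | yes c | no d  = no λ { (inj₁ (_ , b')) → b b' ; (inj₂ (_ , d')) → d d' }

affine-zero⇒oppositeSigns : ∀ {s x y} → 0ℚ < s → s < 1ℚ → (1ℚ - s) * x + s * y ≡ 0ℚ →
  x ≢ 0ℚ ⊎ y ≢ 0ℚ → OppositeSigns x y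
affine-zero⇒oppositeSigns {s} {x} {y} 0<s s<1 eq nz with <-cmp x 0ℚ | <-cmp y 0ℚ
... | tri< x<0 _ _  | tri> _ _ y>0  = inj₂ (x<0 , y>0)
... | tri> _ _ x>0  | tri< y<0 _ _  = inj₁ (x>0 , y<0)
... | tri< x<0 _ _  | tri< y<0 _ _  =
  ⊥-elim (<⇒≢ (+-mono-< (pos*neg<0 (p<q⇒0<q-p s<1) x<0) (pos*neg<0 0<s y<0)) eq)
... | tri< x<0 _ _  | tri≈ _ refl _ =
  ⊥-elim (<⇒≢ (+-mono-<-≤ (pos*neg<0 (p<q⇒0<q-p s<1) x<0) (≤-reflexive (*-zeroʳ s))) eq)
... | tri> _ _ x>0  | tri> _ _ y>0  =
  ⊥-elim (<⇒≢ (+-mono-< (pos*pos>0 (p<q⇒0<q-p s<1) x>0) (pos*pos>0 0<s y>0)) (sym eq))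
... | tri> _ _ x>0  | tri≈ _ refl _ =
  ⊥-elim (<⇒≢ (+-mono-<-≤ (pos*pos>0 (p<q⇒0<q-p s<1) x>0) (≤-reflexive (sym (*-zeroʳ s)))) (sym eq))
... | tri≈ _ refl _ | tri< y<0 _ _  =
  ⊥-elim (<⇒≢ (subst (_< 0ℚ) (sym (trans (cong (_+ s * y) (*-zeroʳ (1ℚ - s))) (+-identityˡ _)))
                 (pos*neg<0 0<s y<0)) eq)
... | tri≈ _ refl _ | tri> _ _ y>0  =
  ⊥-elim (<⇒≢ (subst (0ℚ <_) (sym (trans (cong (_+ s * y) (*-zeroʳ (1ℚ - s))) (+-identityˡ _)))
                 (pos*pos>0 0<s y>0)) (sym eq))
... | tri≈ _ refl _ | tri≈ _ refl _ = ⊥-elim ([ (λ h → h refl) , (λ h → h refl) ] nz)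

private
  1-ratio≡ : ∀ {x y e} → (x - y) * e ≡ 1ℚ → - y * e ≡ 1ℚ - x * e
  1-ratio≡ {x} {y} {e} de =
    trans (solve 3 (λ x y e → :- y :* e := (x :- y) :* e :- x :* e) refl x y e) (cong (_- x * e) de)

oppositeSigns⇒ratio∈unit : ∀ {x y e} → OppositeSigns x y → (x - y) * e ≡ 1ℚ →
  0ℚ < x * e × x * e < 1ℚ
oppositeSigns⇒ratio∈unit {x} {y} {e} opp de with <-cmp e 0ℚ | opp
... | tri≈ _ refl _ | _ = ⊥-elim (<⇒≢ (subst (_< 1ℚ) (sym (*-zeroʳ (x - y))) (positive⁻¹ 1ℚ)) de)
... | tri< e<0 _ _ | inj₁ (x>0 , y<0) =
  ⊥-elim (<-asym (positive⁻¹ 1ℚ) (subst (_< 0ℚ) de (pos*neg<0 (p<q⇒0<q-p (<-trans y<0 x>0)) e<0)))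
... | tri> _ _ e>0 | inj₂ (x<0 , y>0) =
  ⊥-elim (<-asym (positive⁻¹ 1ℚ) (subst (_< 0ℚ) de (neg*pos<0 (p<q⇒p-q<0 (<-trans x<0 y>0)) e>0)))
... | tri> _ _ e>0 | inj₁ (x>0 , y<0) =
  pos*pos>0 x>0 e>0 , 0<q-p⇒p<q (subst (0ℚ <_) (1-ratio≡ {x} {y} de) (pos*pos>0 (neg-antimono-< y<0) e>0))
... | tri< e<0 _ _ | inj₂ (x<0 , y>0) =
  neg*neg>0 x<0 e<0 , 0<q-p⇒p<q (subst (0ℚ <_) (1-ratio≡ {x} {y} de) (neg*neg>0 (neg-antimono-< y>0) e<0))

private
  orientᴾ : ∀ {k} → (px py qx qy rx ry : Polynomial k) → Polynomial k
  orientᴾ px py qx qy rx ry = ((qx :- px) :* (ry :- py)) :- ((qy :- py) :* (rx :- px))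

orient-cyclic : ∀ p q r → orient p q r ≡ orient q r p
orient-cyclic (px , py) (qx , qy) (rx , ry) =
  solve 6 (λ px py qx qy rx ry → orientᴾ px py qx qy rx ry := orientᴾ qx qy rx ry px py)
    refl px py qx qy rx ry

orient-swap₁₂ : ∀ p q r → orient p q r ≡ - orient q p r
orient-swap₁₂ (px , py) (qx , qy) (rx , ry) =
  solve 6 (λ px py qx qy rx ry → orientᴾ px py qx qy rx ry := :- orientᴾ qx qy px py rx ry)
    refl px py qx qy rx ry

orient-swap₂₃ : ∀ p q r → orient p q r ≡ - orient p r q
orient-swap₂₃ (px , py) (qx , qy) (rx , ry) =
  solve 6 (λ px py qx qy rx ry → orientᴾ px py qx qy rx ry := :- orientᴾ px py rx ry qx qy)
    refl px py qx qy rx ry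

orient-repeat₁₂ : ∀ p r → orient p p r ≡ 0ℚ
orient-repeat₁₂ (px , py) (rx , ry) =
  solve 4 (λ px py rx ry → orientᴾ px py px py rx ry := con 0ℚ) refl px py rx ry

orient-repeat₁₃ : ∀ p q → orient p q p ≡ 0ℚ
orient-repeat₁₃ (px , py) (qx , qy) =
  solve 4 (λ px py qx qy → orientᴾ px py qx qy px py := con 0ℚ) refl px py qx qy

orient-repeat₂₃ : ∀ p q → orient p q q ≡ 0ℚ
orient-repeat₂₃ (px , py) (qx , qy) =
  solve 4 (λ px py qx qy → orientᴾ px py qx qy qx qy := con 0ℚ) refl px py qx qy

orient-cong : ∀ {p p' q q' r r'} → p ≡ p' → q ≡ q' → r ≡ r' → orient p q r ≡ orient p' q' r'
orient-cong refl refl refl = refl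

-- For x-ordered u, v, w, the side of v with respect to the line pq is controlled by the sides
-- of u and w and by the turn u w v.
orient-interpolate : ∀ p q u v w →
  (xc w - xc u) * orient p q v ≡
  ((xc w - xc v) * orient p q u + (xc v - xc u) * orient p q w) + (xc q - xc p) * orient u w v
orient-interpolate (px , py) (qx , qy) (ux , uy) (vx , vy) (wx , wy) =
  solve 10 (λ px py qx qy ux uy vx vy wx wy →
    (wx :- ux) :* orientᴾ px py qx qy vx vy :=
    ((wx :- vx) :* orientᴾ px py qx qy ux uy :+ (vx :- ux) :* orientᴾ px py qx qy wx wy)
      :+ (qx :- px) :* orientᴾ ux uy wx wy vx vy)
    refl px py qx qy ux uy vx vy wx wy

orient-sub-exchange : ∀ a b c d → orient a b d - orient a b c ≡ orient c d a - orient c d b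
orient-sub-exchange (ax , ay) (bx , by) (cx , cy) (dx , dy) =
  solve 8 (λ ax ay bx by cx cy dx dy →
    orientᴾ ax ay bx by dx dy :- orientᴾ ax ay bx by cx cy :=
    orientᴾ cx cy dx dy ax ay :- orientᴾ cx cy dx dy bx by)
    refl ax ay bx by cx cy dx dy

private
  orient-barycentric-x : ∀ p q r v →
    (orient q r v + orient r p v + orient p q v) * xc v ≡
    (orient q r v * xc p + orient r p v * xc q) + orient p q v * xc r
  orient-barycentric-x (px , py) (qx , qy) (rx , ry) (vx , vy) =
    solve 8 (λ px py qx qy rx ry vx vy →
      (orientᴾ qx qy rx ry vx vy :+ orientᴾ rx ry px py vx vy :+ orientᴾ px py qx qy vx vy) :* vx :=
      (orientᴾ qx qy rx ry vx vy :* px :+ orientᴾ rx ry px py vx vy :* qx) :+ orientᴾ px py qx qy vx vy :* rx)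
      refl px py qx qy rx ry vx vy

  orient-barycentric-y : ∀ p q r v →
    (orient q r v + orient r p v + orient p q v) * yc v ≡
    (orient q r v * yc p + orient r p v * yc q) + orient p q v * yc r
  orient-barycentric-y (px , py) (qx , qy) (rx , ry) (vx , vy) =
    solve 8 (λ px py qx qy rx ry vx vy →
      (orientᴾ qx qy rx ry vx vy :+ orientᴾ rx ry px py vx vy :+ orientᴾ px py qx qy vx vy) :* vy :=
      (orientᴾ qx qy rx ry vx vy :* py :+ orientᴾ rx ry px py vx vy :* qy) :+ orientᴾ px py qx qy vx vy :* ry)
      refl px py qx qy rx ry vx vy

  normalise-weights : ∀ D e X a b c x y z → D * e ≡ 1ℚ → D * X ≡ (a * x + b * y) + c * z →
    X ≡ ((a * e) * x + (b * e) * y) + (c * e) * z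
  normalise-weights D e X a b c x y z De eq = begin
    X                                         ≡⟨ *-identityˡ X ⟨
    1ℚ * X                                    ≡⟨ cong (_* X) De ⟨
    (D * e) * X                               ≡⟨ solve 3 (λ D e X → (D :* e) :* X := e :* (D :* X)) refl D e X ⟩
    e * (D * X)                               ≡⟨ cong (e *_) eq ⟩
    e * ((a * x + b * y) + c * z)             ≡⟨ solve 7 (λ e a b c x y z → e :* ((a :* x :+ b :* y) :+ c :* z) :=
                                                   ((a :* e) :* x :+ (b :* e) :* y) :+ (c :* e) :* z) refl e a b c x y z ⟩
    ((a * e) * x + (b * e) * y) + (c * e) * z ∎
    where open ≡-Reasoning

-- The barycentric coordinates of v are proportional to the three orientations.
orient≥0⇒inHull3 : ∀ p q r v → 0ℚ ≤ orient q r v → 0ℚ ≤ orient r p v → 0ℚ < orient p q v → InHull3 p q r v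
orient≥0⇒inHull3 p q r v h₁ h₂ h₃ =
  o₁ * e , o₂ * e , o₃ * e ,
  nonNeg*nonNeg≥0 h₁ (<⇒≤ e>0) , nonNeg*nonNeg≥0 h₂ (<⇒≤ e>0) , nonNeg*nonNeg≥0 (<⇒≤ h₃) (<⇒≤ e>0) ,
  trans (solve 4 (λ a b c e → (a :* e :+ b :* e) :+ c :* e := (a :+ b :+ c) :* e) refl o₁ o₂ o₃ e) De≡1 ,
  normalise-weights D e (xc v) o₁ o₂ o₃ (xc p) (xc q) (xc r) De≡1 (orient-barycentric-x p q r v) ,
  normalise-weights D e (yc v) o₁ o₂ o₃ (yc p) (yc q) (yc r) De≡1 (orient-barycentric-y p q r v)
  where
  o₁ = orient q r v
  o₂ = orient r p v
  o₃ = orient p q v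
  D = o₁ + o₂ + o₃
  D>0 : 0ℚ < D
  D>0 = subst (0ℚ <_) (+-comm o₃ (o₁ + o₂)) (+-mono-<-≤ h₃ (+-mono-≤ h₁ h₂))
  instance
    D≢0 = pos⇒nonZero D {{positive D>0}}
  e = 1/ D
  e>0 : 0ℚ < e
  e>0 = positive⁻¹ _ {{1/pos⇒pos D {{positive D>0}}}}
  De≡1 : D * e ≡ 1ℚ
  De≡1 = *-inverseʳ D

Separates : Point → Point → Point → Point → Set
Separates a b c d = OppositeSigns (orient a b c) (orient a b d)

Crossing : Point → Point → Point → Point → Set
Crossing a b c d = Separates a b c d × Separates c d a b

Crossing-reverse : ∀ {a b c d} → Crossing a b c d → Crossing b a d c
Crossing-reverse {a} {b} {c} {d} (ab , cd) = reverse a b c d ab , reverse c d a b cd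
  where
  reverse : ∀ a b c d → Separates a b c d → Separates b a d c
  reverse a b c d h = subst₂ OppositeSigns (sym (orient-swap₁₂ b a d)) (sym (orient-swap₁₂ b a c))
                        (OppositeSigns-sym (OppositeSigns-neg h))

SegCross-sym : ∀ {a b c d} → SegCross a b c d → SegCross c d a b
SegCross-sym (t , s , 0<t , t<1 , 0<s , s<1 , ex , ey) = s , t , 0<s , s<1 , 0<t , t<1 , sym ex , sym ey

pointOn : Point → Point → ℚ → Point
pointOn a b t = (xc a + t * (xc b - xc a)) , (yc a + t * (yc b - yc a))

orient-pointOn-line : ∀ a b t → orient a b (pointOn a b t) ≡ 0ℚ
orient-pointOn-line (ax , ay) (bx , by) t =
  solve 5 (λ ax ay bx by t →
    orientᴾ ax ay bx by (ax :+ t :* (bx :- ax)) (ay :+ t :* (by :- ay)) := con 0ℚ)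
    refl ax ay bx by t

orient-pointOn : ∀ a b c d s → orient a b (pointOn c d s) ≡ (1ℚ - s) * orient a b c + s * orient a b d
orient-pointOn (ax , ay) (bx , by) (cx , cy) (dx , dy) s =
  solve 9 (λ ax ay bx by cx cy dx dy s →
    orientᴾ ax ay bx by (cx :+ s :* (dx :- cx)) (cy :+ s :* (dy :- cy)) :=
    (con 1ℚ :- s) :* orientᴾ ax ay bx by cx cy :+ s :* orientᴾ ax ay bx by dx dy)
    refl ax ay bx by cx cy dx dy s

segCross⇒separates : ∀ a b c d → SegCross a b c d → orient a b c ≢ 0ℚ ⊎ orient a b d ≢ 0ℚ →
  Separates a b c d
segCross⇒separates a b c d (t , s , _ , _ , 0<s , s<1 , ex , ey) =
  affine-zero⇒oppositeSigns 0<s s<1 (begin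
    (1ℚ - s) * orient a b c + s * orient a b d ≡⟨ orient-pointOn a b c d s ⟨
    orient a b (pointOn c d s)                 ≡⟨ cong (orient a b) (cong₂ _,_ ex ey) ⟨
    orient a b (pointOn a b t)                 ≡⟨ orient-pointOn-line a b t ⟩
    0ℚ                                         ∎)
  where open ≡-Reasoning

private
  rescale : ∀ K e a₀ o Δ → K * e ≡ 1ℚ → a₀ + (o * e) * Δ ≡ e * (K * a₀ + o * Δ)
  rescale K e a₀ o Δ Ke = begin
    a₀ + (o * e) * Δ            ≡⟨ cong (_+ (o * e) * Δ) (*-identityˡ a₀) ⟨
    1ℚ * a₀ + (o * e) * Δ       ≡⟨ cong (λ z → z * a₀ + (o * e) * Δ) Ke ⟨
    (K * e) * a₀ + (o * e) * Δ  ≡⟨ solve 5 (λ K e a₀ o Δ → (K :* e) :* a₀ :+ (o :* e) :* Δ :=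
                                                           e :* (K :* a₀ :+ o :* Δ)) refl K e a₀ o Δ ⟩
    e * (K * a₀ + o * Δ)        ∎
    where open ≡-Reasoning

  crossing-x : ∀ a b c d →
    (orient c d a - orient c d b) * xc a + orient c d a * (xc b - xc a) ≡
    - ((orient a b c - orient a b d) * xc c + orient a b c * (xc d - xc c))
  crossing-x (ax , ay) (bx , by) (cx , cy) (dx , dy) =
    solve 8 (λ ax ay bx by cx cy dx dy →
      (orientᴾ cx cy dx dy ax ay :- orientᴾ cx cy dx dy bx by) :* ax :+ orientᴾ cx cy dx dy ax ay :* (bx :- ax) :=
      :- ((orientᴾ ax ay bx by cx cy :- orientᴾ ax ay bx by dx dy) :* cx :+ orientᴾ ax ay bx by cx cy :* (dx :- cx)))
      refl ax ay bx by cx cy dx dy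

  crossing-y : ∀ a b c d →
    (orient c d a - orient c d b) * yc a + orient c d a * (yc b - yc a) ≡
    - ((orient a b c - orient a b d) * yc c + orient a b c * (yc d - yc c))
  crossing-y (ax , ay) (bx , by) (cx , cy) (dx , dy) =
    solve 8 (λ ax ay bx by cx cy dx dy →
      (orientᴾ cx cy dx dy ax ay :- orientᴾ cx cy dx dy bx by) :* ay :+ orientᴾ cx cy dx dy ax ay :* (by :- ay) :=
      :- ((orientᴾ ax ay bx by cx cy :- orientᴾ ax ay bx by dx dy) :* cy :+ orientᴾ ax ay bx by cx cy :* (dy :- cy)))
      refl ax ay bx by cx cy dx dy

-- The crossing point is a + t (b - a) with t = orient c d a / (orient c d a - orient c d b),
-- and symmetrically c + s (d - c).
crossing⇒segCross : ∀ a b c d → Crossing a b c d → SegCross a b c d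
crossing⇒segCross a b c d (ab , cd) =
  t , s , proj₁ t∈unit , proj₂ t∈unit , proj₁ s∈unit , proj₂ s∈unit ,
  meet (xc a) (xc b) (xc c) (xc d) (crossing-x a b c d) ,
  meet (yc a) (yc b) (yc c) (yc d) (crossing-y a b c d)
  where
  open ≡-Reasoning
  K = orient c d a - orient c d b
  D = orient a b c - orient a b d
  instance
    K≢0 = ≢-nonZero (OppositeSigns⇒≢ cd)
  e = 1/ K
  e' = - e
  Ke≡1 : K * e ≡ 1ℚ
  Ke≡1 = *-inverseʳ K
  De'≡1 : D * e' ≡ 1ℚ
  De'≡1 = begin
    D * - e       ≡⟨ cong (_* - e) (trans (solve 2 (λ u v → u :- v := :- (v :- u)) refl (orient a b c) (orient a b d))
                                          (cong -_ (orient-sub-exchange a b c d))) ⟩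
    (- K) * - e   ≡⟨ solve 2 (λ K e → (:- K) :* (:- e) := K :* e) refl K e ⟩
    K * e         ≡⟨ Ke≡1 ⟩
    1ℚ            ∎
  t = orient c d a * e
  s = orient a b c * e'
  t∈unit = oppositeSigns⇒ratio∈unit cd Ke≡1
  s∈unit = oppositeSigns⇒ratio∈unit ab De'≡1

  meet : ∀ a₀ a₁ c₀ c₁ → K * a₀ + orient c d a * (a₁ - a₀) ≡ - (D * c₀ + orient a b c * (c₁ - c₀)) →
         a₀ + t * (a₁ - a₀) ≡ c₀ + s * (c₁ - c₀)
  meet a₀ a₁ c₀ c₁ eq = begin
    a₀ + t * (a₁ - a₀)                            ≡⟨ rescale K e a₀ (orient c d a) (a₁ - a₀) Ke≡1 ⟩
    e * (K * a₀ + orient c d a * (a₁ - a₀))       ≡⟨ cong (e *_) eq ⟩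
    e * - (D * c₀ + orient a b c * (c₁ - c₀))     ≡⟨ solve 2 (λ e X → e :* (:- X) := (:- e) :* X) refl e (D * c₀ + orient a b c * (c₁ - c₀)) ⟩
    e' * (D * c₀ + orient a b c * (c₁ - c₀))      ≡⟨ rescale D e' c₀ (orient a b c) (c₁ - c₀) De'≡1 ⟨
    c₀ + s * (c₁ - c₀)                            ∎

SignReversed : ℚ → ℚ → Set
SignReversed x y = OppositeSigns x y ⊎ (x ≡ 0ℚ × y ≡ 0ℚ)

SignReversed-sym : ∀ {x y} → SignReversed x y → SignReversed y x
SignReversed-sym (inj₁ h) = inj₁ (OppositeSigns-sym h)
SignReversed-sym (inj₂ (x≡0 , y≡0)) = inj₂ (y≡0 , x≡0)

SignReversed-neg : ∀ {x y} → SignReversed x y → SignReversed (- x) (- y)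
SignReversed-neg (inj₁ h) = inj₁ (OppositeSigns-neg h)
SignReversed-neg (inj₂ (refl , refl)) = inj₂ (refl , refl)

SignReversed-pos : ∀ {x y} → SignReversed x y → 0ℚ < x → y < 0ℚ
SignReversed-pos (inj₁ (inj₁ (_ , y<0))) _ = y<0
SignReversed-pos (inj₁ (inj₂ (x<0 , _))) x>0 = ⊥-elim (<-asym x<0 x>0)
SignReversed-pos (inj₂ (refl , _)) x>0 = ⊥-elim (<-irrefl refl x>0)

SignReversed-neg⁻ : ∀ {x y} → SignReversed x y → x < 0ℚ → 0ℚ < y
SignReversed-neg⁻ (inj₁ (inj₂ (_ , y>0))) _ = y>0
SignReversed-neg⁻ (inj₁ (inj₁ (x>0 , _))) x<0 = ⊥-elim (<-asym x<0 x>0)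
SignReversed-neg⁻ (inj₂ (refl , _)) x<0 = ⊥-elim (<-irrefl refl x<0)

OppositeSigns-reversed : ∀ {x y x' y'} → SignReversed x x' → SignReversed y y' →
  OppositeSigns x y → OppositeSigns x' y'
OppositeSigns-reversed xx' yy' (inj₁ (x>0 , y<0)) = inj₂ (SignReversed-pos xx' x>0 , SignReversed-neg⁻ yy' y<0)
OppositeSigns-reversed xx' yy' (inj₂ (x<0 , y>0)) = inj₁ (SignReversed-neg⁻ xx' x<0 , SignReversed-pos yy' y>0)

ReversedOrientations : {V : Set} → (V → Point) → (V → Point) → Set
ReversedOrientations p q = ∀ u v w → SignReversed (orient (p u) (p v) (p w)) (orient (q u) (q v) (q w))

ReversedOrientations-sym : ∀ {V} {p q : V → Point} → ReversedOrientations p q → ReversedOrientations q p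
ReversedOrientations-sym rev u v w = SignReversed-sym (rev u v w)

ReversedOrientations-involution : ∀ {V} {p q : V → Point} (σ : V → V) → (∀ v → σ (σ v) ≡ v) →
  ReversedOrientations p (λ v → q (σ v)) → ReversedOrientations q (λ v → p (σ v))
ReversedOrientations-involution {p = p} {q} σ σ-involutive rev u v w =
  SignReversed-sym (subst (SignReversed (orient (p (σ u)) (p (σ v)) (p (σ w))))
    (orient-cong (cong q (σ-involutive u)) (cong q (σ-involutive v)) (cong q (σ-involutive w)))
    (rev (σ u) (σ v) (σ w)))

module _ {V : Set} {p q : V → Point} (rev : ReversedOrientations p q) where

  separates-reversed : ∀ a b c d → Separates (p a) (p b) (p c) (p d) → Separates (q a) (q b) (q c) (q d)
  separates-reversed a b c d = OppositeSigns-reversed (rev a b c) (rev a b d)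

  crossing-reversed : ∀ a b c d → Crossing (p a) (p b) (p c) (p d) → Crossing (q a) (q b) (q c) (q d)
  crossing-reversed a b c d (ab , cd) = separates-reversed a b c d ab , separates-reversed c d a b cd

LeftTurn : Point → Point → Point → Point → Set
LeftTurn a b c d = (yc b - yc a) * (xc d - xc c) < (yc d - yc c) * (xc b - xc a)

private
  leftTurn-gap : ∀ a b c d →
    (yc d - yc c) * (xc b - xc a) - (yc b - yc a) * (xc d - xc c) ≡ orient a b d - orient a b c
  leftTurn-gap (ax , ay) (bx , by) (cx , cy) (dx , dy) =
    solve 8 (λ ax ay bx by cx cy dx dy →
      (dy :- cy) :* (bx :- ax) :- (by :- ay) :* (dx :- cx) :=
      orientᴾ ax ay bx by dx dy :- orientᴾ ax ay bx by cx cy)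
      refl ax ay bx by cx cy dx dy

  leftTurn-gap′ : ∀ a b c d →
    (yc b - yc a) * (xc d - xc c) - (yc d - yc c) * (xc b - xc a) ≡ orient a b c - orient a b d
  leftTurn-gap′ (ax , ay) (bx , by) (cx , cy) (dx , dy) =
    solve 8 (λ ax ay bx by cx cy dx dy →
      (by :- ay) :* (dx :- cx) :- (dy :- cy) :* (bx :- ax) :=
      orientᴾ ax ay bx by cx cy :- orientᴾ ax ay bx by dx dy)
      refl ax ay bx by cx cy dx dy

leftTurn⇒orient< : ∀ a b c d → LeftTurn a b c d → orient a b c < orient a b d
leftTurn⇒orient< a b c d h = 0<q-p⇒p<q (subst (0ℚ <_) (leftTurn-gap a b c d) (p<q⇒0<q-p h))

orient>⇒leftTurn : ∀ a b c d → orient a b d < orient a b c → LeftTurn c d a b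
orient>⇒leftTurn a b c d h = 0<q-p⇒p<q (subst (0ℚ <_) (sym (leftTurn-gap′ a b c d)) (p<q⇒0<q-p h))

LeftTurn-reverse : ∀ {a b c d} → LeftTurn a b c d → LeftTurn b a d c
LeftTurn-reverse {a} {b} {c} {d} =
  subst₂ _<_ (flip² (yc b) (yc a) (xc d) (xc c)) (flip² (yc d) (yc c) (xc b) (xc a))
  where
  flip² : ∀ u v w z → (u - v) * (w - z) ≡ (v - u) * (z - w)
  flip² = solve 4 (λ u v w z → (u :- v) :* (w :- z) := (v :- u) :* (z :- w)) refl

-- For crossing segments the turn of their directions is read off the orientations,
-- so it is reversed along with them.
leftTurn-reversed : ∀ {V} {p q : V → Point} → ReversedOrientations p q → ∀ a b c d →
  Separates (p a) (p b) (p c) (p d) → LeftTurn (p a) (p b) (p c) (p d) → LeftTurn (q c) (q d) (q a) (q b)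
leftTurn-reversed {p = p} {q} rev a b c d sep turn =
  orient>⇒leftTurn (q a) (q b) (q c) (q d) (reverse sep (leftTurn⇒orient< (p a) (p b) (p c) (p d) turn))
  where
  reverse : Separates (p a) (p b) (p c) (p d) → orient (p a) (p b) (p c) < orient (p a) (p b) (p d) →
            orient (q a) (q b) (q d) < orient (q a) (q b) (q c)
  reverse (inj₁ (c>0 , d<0)) c<d = ⊥-elim (<-asym c<d (<-trans d<0 c>0))
  reverse (inj₂ (c<0 , d>0)) _ = <-trans (SignReversed-pos (rev a b d) d>0) (SignReversed-neg⁻ (rev a b c) c<0)

record ConvexChain (m : ℕ) : Set where
  field
    point        : ℕ → Point
    sign         : ℕ → Sign
    x-increasing : ∀ r → suc r ℕ.≤ m → xc (point r) < xc (point (suc r))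
    side         : ∀ j → 0 ℕ.< j → j ℕ.< m → SideOK (sign j) (point 0) (point m) (point j)
    convex       : ∀ a b c d → a ℕ.≤ m → b ℕ.≤ m → c ℕ.≤ m → d ℕ.≤ m →
                   a ≢ b → a ≢ c → a ≢ d → b ≢ c → b ≢ d → c ≢ d →
                   ¬ InHull3 (point a) (point b) (point c) (point d)

module Chain {m : ℕ} (R : ConvexChain m) where
  open ConvexChain R

  private
    A = point 0
    B = point m

  x-mono : ∀ {i j} → i ℕ.< j → j ℕ.≤ m → xc (point i) < xc (point j)
  x-mono {i} {suc j} (s≤s i≤j) j<m with ℕₚ.m≤n⇒m<n∨m≡n i≤j
  ... | inj₂ refl = x-increasing i j<m
  ... | inj₁ i<j  = <-trans (x-mono i<j (ℕₚ.<⇒≤ j<m)) (x-increasing j j<m)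

  Δx>0 : ∀ {i j} → i ℕ.< j → j ℕ.≤ m → 0ℚ < xc (point j) - xc (point i)
  Δx>0 i<j j≤m = p<q⇒0<q-p (x-mono i<j j≤m)

  Δx≥0 : ∀ {i j} → i ℕ.≤ j → j ℕ.≤ m → 0ℚ ≤ xc (point j) - xc (point i)
  Δx≥0 {i} i≤j j≤m with ℕₚ.m≤n⇒m<n∨m≡n i≤j
  ... | inj₁ i<j  = <⇒≤ (Δx>0 i<j j≤m)
  ... | inj₂ refl = p≤q⇒0≤q-p (≤-refl {xc (point i)})

  side-plus : ∀ {j} → 0 ℕ.< j → j ℕ.< m → sign j ≡ plus → 0ℚ < orient A B (point j)
  side-plus {j} 0<j j<m s≡+ with sign j | side j 0<j j<m
  side-plus 0<j j<m refl | plus | h = h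

  side-minus : ∀ {j} → 0 ℕ.< j → j ℕ.< m → sign j ≡ minus → orient A B (point j) < 0ℚ
  side-minus {j} 0<j j<m s≡- with sign j | side j 0<j j<m
  side-minus 0<j j<m refl | minus | h = h

  Upper : ℕ → Set
  Upper r = 0 ℕ.< r × r ℕ.< m × sign r ≡ plus

  upper? : ∀ r → Dec (Upper r)
  upper? r with 0 ℕ.<? r | r ℕ.<? m | sign r
  ... | yes 0<r | yes r<m | plus  = yes (0<r , r<m , refl)
  ... | yes _   | yes _   | minus = no λ { (_ , _ , ()) }
  ... | no 0≮r  | _       | _     = no λ u → 0≮r (proj₁ u)
  ... | yes _   | no r≮m  | _     = no λ u → r≮m (proj₁ (proj₂ u))

  upper⇒above : ∀ {r} → Upper r → 0ℚ < orient A B (point r)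
  upper⇒above (0<r , r<m , s≡+) = side-plus 0<r r<m s≡+

  ¬upper⇒not-above : ∀ r → r ℕ.≤ m → ¬ Upper r → orient A B (point r) ≤ 0ℚ
  ¬upper⇒not-above zero _ _ = ≤-reflexive (orient-repeat₁₃ A B)
  ¬upper⇒not-above (suc r) r<m ¬up with suc r ℕ.<? m
  ... | no r≮m rewrite ℕₚ.≤-antisym r<m (ℕₚ.≮⇒≥ r≮m) = ≤-reflexive (orient-repeat₂₃ A B)
  ... | yes r<m with sign (suc r) in s≡
  ...   | plus  = ⊥-elim (¬up (s≤s z≤n , r<m , refl))
  ...   | minus = <⇒≤ (side-minus (s≤s z≤n) r<m s≡)

  module _ {a x y b : ℕ} (a<x : a ℕ.< x) (x<y : x ℕ.< y) (y<b : y ℕ.< b) (b≤m : b ℕ.≤ m) where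
    private
      a<y = ℕₚ.<-trans a<x x<y
      x<b = ℕₚ.<-trans x<y y<b
      a<b = ℕₚ.<-trans a<y y<b
      y≤m = ℕₚ.<⇒≤ (ℕₚ.<-≤-trans y<b b≤m)
      x≤m = ℕₚ.<⇒≤ (ℕₚ.<-≤-trans x<b b≤m)
      a≤m = ℕₚ.<⇒≤ (ℕₚ.<-≤-trans a<b b≤m)

    ∉hull-inner : ¬ InHull3 (point a) (point b) (point y) (point x)
    ∉hull-inner = convex a b y x a≤m b≤m y≤m x≤m
      (ℕₚ.<⇒≢ a<b) (ℕₚ.<⇒≢ a<y) (ℕₚ.<⇒≢ a<x) (ℕₚ.>⇒≢ y<b) (ℕₚ.>⇒≢ x<b) (ℕₚ.>⇒≢ x<y)

    ∉hull-outer : ¬ InHull3 (point a) (point b) (point x) (point y)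
    ∉hull-outer = convex a b x y a≤m b≤m x≤m y≤m
      (ℕₚ.<⇒≢ a<b) (ℕₚ.<⇒≢ a<x) (ℕₚ.<⇒≢ a<y) (ℕₚ.>⇒≢ x<b) (ℕₚ.>⇒≢ y<b) (ℕₚ.<⇒≢ x<y)

  -- Either the far end of the chord is an upper vertex, and then convexity is violated,
  -- or it is not, and then interpolation puts point j on or below the line A B.
  upper-above-chord-from-start : ∀ {j k} → 0 ℕ.< j → j ℕ.< k → k ℕ.≤ m → sign j ≡ plus →
    0ℚ < orient A (point k) (point j)
  upper-above-chord-from-start {j} {k} 0<j j<k k≤m s≡+ =
    pos-by-contradiction λ below → refute below (upper? k)
    where
    j<m = ℕₚ.<-≤-trans j<k k≤m
    v = point j
    w = point k
    v-above = side-plus 0<j j<m s≡+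
    refute : orient A w v ≤ 0ℚ → Dec (Upper k) → ⊥
    refute below (yes up@(_ , k<m , _)) =
      ∉hull-inner 0<j j<k k<m ℕₚ.≤-refl (orient≥0⇒inHull3 A B w v
        (≥0-of-neg≤0 (orient-swap₁₂ B w v) w-side)
        (≥0-of-neg≤0 (trans (orient-cyclic w A v) (orient-swap₂₃ A v w)) below)
        v-above)
      where
      w-side : orient w B v ≤ 0ℚ
      w-side = weighted-sum-nonpos (Δx>0 (ℕₚ.<-trans 0<j j<k) k≤m) (orient-interpolate w B A v w)
        (Δx≥0 (ℕₚ.<⇒≤ j<k) k≤m)
        (≤0-of-neg≥0 (trans (orient-cyclic w B A) (orient-swap₁₂ B A w)) (<⇒≤ (upper⇒above up)))
        (Δx≥0 z≤n (ℕₚ.<⇒≤ j<m)) (≤-reflexive (orient-repeat₁₃ w B))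
        (Δx≥0 k≤m ℕₚ.≤-refl) below
    refute below (no ¬up) = <⇒≱ v-above
      (weighted-sum-nonpos (Δx>0 (ℕₚ.<-trans 0<j j<k) k≤m) (orient-interpolate A B A v w)
        (Δx≥0 (ℕₚ.<⇒≤ j<k) k≤m) (≤-reflexive (orient-repeat₁₃ A B))
        (Δx≥0 z≤n (ℕₚ.<⇒≤ j<m)) (¬upper⇒not-above k k≤m ¬up)
        (Δx≥0 z≤n ℕₚ.≤-refl) below)

  upper-above-chord-to-end : ∀ {i j} → i ℕ.< j → j ℕ.< m → sign j ≡ plus → 0ℚ < orient (point i) B (point j)
  upper-above-chord-to-end {i} {j} i<j j<m s≡+ =
    pos-by-contradiction λ below → refute below (upper? i)
    where
    0<j = ℕₚ.≤-<-trans z≤n i<j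
    i<m = ℕₚ.<-trans i<j j<m
    u = point i
    v = point j
    v-above = side-plus 0<j j<m s≡+
    refute : orient u B v ≤ 0ℚ → Dec (Upper i) → ⊥
    refute below (yes up@(0<i , _ , _)) =
      ∉hull-outer 0<i i<j j<m ℕₚ.≤-refl (orient≥0⇒inHull3 A B u v
        (≥0-of-neg≤0 (orient-swap₁₂ B u v) below)
        (≥0-of-neg≤0 (orient-swap₁₂ u A v) u-side)
        v-above)
      where
      u-side : orient A u v ≤ 0ℚ
      u-side = weighted-sum-nonpos (Δx>0 i<m ℕₚ.≤-refl) (orient-interpolate A u u v B)
        (Δx≥0 (ℕₚ.<⇒≤ j<m) ℕₚ.≤-refl) (≤-reflexive (orient-repeat₂₃ A u))
        (Δx≥0 (ℕₚ.<⇒≤ i<j) (ℕₚ.<⇒≤ j<m)) (≤0-of-neg≥0 (orient-swap₂₃ A u B) (<⇒≤ (upper⇒above up)))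
        (Δx≥0 z≤n (ℕₚ.<⇒≤ i<m)) below
    refute below (no ¬up) = <⇒≱ v-above
      (weighted-sum-nonpos (Δx>0 i<m ℕₚ.≤-refl) (orient-interpolate A B u v B)
        (Δx≥0 (ℕₚ.<⇒≤ j<m) ℕₚ.≤-refl) (¬upper⇒not-above i (ℕₚ.<⇒≤ i<m) ¬up)
        (Δx≥0 (ℕₚ.<⇒≤ i<j) (ℕₚ.<⇒≤ j<m)) (≤-reflexive (orient-repeat₂₃ A B))
        (Δx≥0 z≤n ℕₚ.≤-refl) below)

  upper-above-chord : ∀ {i j k} → i ℕ.< j → j ℕ.< k → k ℕ.≤ m → sign j ≡ plus →
    0ℚ < orient (point i) (point k) (point j)
  upper-above-chord {i} {j} {k} i<j j<k k≤m s≡+ =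
    pos-by-contradiction λ below → refute below (upper? i) (upper? k)
    where
    j<m = ℕₚ.<-≤-trans j<k k≤m
    0<j = ℕₚ.≤-<-trans z≤n i<j
    i<k = ℕₚ.<-trans i<j j<k
    u = point i
    v = point j
    w = point k
    v-above = side-plus 0<j j<m s≡+
    flip : orient u w v ≤ 0ℚ → 0ℚ ≤ orient w u v
    flip = ≥0-of-neg≤0 (trans (orient-cyclic w u v) (orient-swap₂₃ u v w))
    refute : orient u w v ≤ 0ℚ → Dec (Upper i) → Dec (Upper k) → ⊥
    refute below (yes (0<i , _ , s≡+ᵢ)) _ =
      ∉hull-outer 0<i i<j j<k k≤m (orient≥0⇒inHull3 A w u v
        (flip below)
        (subst (0ℚ ≤_) (sym (orient-cyclic u A v))
          (<⇒≤ (upper-above-chord-from-start 0<i i<j (ℕₚ.<⇒≤ j<m) s≡+ᵢ)))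
        (upper-above-chord-from-start 0<j j<k k≤m s≡+))
    refute below (no _) (yes (_ , k<m , s≡+ₖ)) =
      ∉hull-inner i<j j<k k<m ℕₚ.≤-refl (orient≥0⇒inHull3 u B w v
        (subst (0ℚ ≤_) (sym (trans (orient-cyclic B w v) (orient-cyclic w v B)))
          (<⇒≤ (upper-above-chord-to-end j<k k<m s≡+ₖ)))
        (flip below)
        (upper-above-chord-to-end i<j j<m s≡+))
    refute below (no ¬upᵢ) (no ¬upₖ) = <⇒≱ v-above
      (weighted-sum-nonpos (Δx>0 i<k k≤m) (orient-interpolate A B u v w)
        (Δx≥0 (ℕₚ.<⇒≤ j<k) k≤m) (¬upper⇒not-above i (ℕₚ.<⇒≤ (ℕₚ.<-trans i<j j<m)) ¬upᵢ)
        (Δx≥0 (ℕₚ.<⇒≤ i<j) (ℕₚ.<⇒≤ j<m)) (¬upper⇒not-above k k≤m ¬upₖ)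
        (Δx≥0 z≤n ℕₚ.≤-refl) below)

mirror : Point → Point
mirror p = xc p , - yc p

orient-mirror : ∀ p q r → orient (mirror p) (mirror q) (mirror r) ≡ - orient p q r
orient-mirror (px , py) (qx , qy) (rx , ry) =
  solve 6 (λ px py qx qy rx ry → orientᴾ px (:- py) qx (:- qy) rx (:- ry) := :- orientᴾ px py qx qy rx ry)
    refl px py qx qy rx ry

inHull3-mirror⁻ : ∀ a b c v → InHull3 (mirror a) (mirror b) (mirror c) (mirror v) → InHull3 a b c v
inHull3-mirror⁻ a b c v (l₁ , l₂ , l₃ , l₁≥0 , l₂≥0 , l₃≥0 , sum≡1 , ex , ey) =
  l₁ , l₂ , l₃ , l₁≥0 , l₂≥0 , l₃≥0 , sum≡1 , ex , (begin
    yc v                                                ≡⟨ neg-involutive (yc v) ⟨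
    - (- yc v)                                          ≡⟨ cong -_ ey ⟩
    - ((l₁ * - yc a + l₂ * - yc b) + l₃ * - yc c)       ≡⟨ solve 6 (λ l₁ l₂ l₃ a b c →
        :- ((l₁ :* (:- a) :+ l₂ :* (:- b)) :+ l₃ :* (:- c)) := (l₁ :* a :+ l₂ :* b) :+ l₃ :* c)
        refl l₁ l₂ l₃ (yc a) (yc b) (yc c) ⟩
    (l₁ * yc a + l₂ * yc b) + l₃ * yc c                 ∎)
  where open ≡-Reasoning

SideOK-mirror : ∀ s a b p → SideOK s a b p → SideOK (neg s) (mirror a) (mirror b) (mirror p)
SideOK-mirror plus  a b p h = subst (_< 0ℚ) (sym (orient-mirror a b p)) (neg-antimono-< h)
SideOK-mirror minus a b p h = subst (0ℚ <_) (sym (orient-mirror a b p)) (neg-antimono-< h)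

mirrorChain : ∀ {m} → ConvexChain m → ConvexChain m
mirrorChain {m} R = record
  { point        = λ r → mirror (point r)
  ; sign         = λ r → neg (sign r)
  ; x-increasing = x-increasing
  ; side         = λ j 0<j j<m → SideOK-mirror (sign j) _ _ _ (side j 0<j j<m)
  ; convex       = λ a b c d a≤m b≤m c≤m d≤m a≢b a≢c a≢d b≢c b≢d c≢d h →
      convex a b c d a≤m b≤m c≤m d≤m a≢b a≢c a≢d b≢c b≢d c≢d (inHull3-mirror⁻ _ _ _ _ h)
  }
  where open ConvexChain R

chord-side : ∀ {m} (R : ConvexChain m) → let open ConvexChain R in
  ∀ {i j k} → i ℕ.< j → j ℕ.< k → k ℕ.≤ m → SideOK (sign j) (point i) (point k) (point j)
chord-side R {i} {j} {k} i<j j<k k≤m with ConvexChain.sign R j in s≡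
... | plus  = Chain.upper-above-chord R i<j j<k k≤m s≡
... | minus = 0<neg⇒<0 (subst (0ℚ <_) (orient-mirror (point i) (point k) (point j))
                (Chain.upper-above-chord (mirrorChain R) i<j j<k k≤m (cong neg s≡)))
  where open ConvexChain R

on-all-triples : ∀ m (P : ℕ → ℕ → ℕ → Set) →
  (∀ {a b c} → P a b c → P b c a) → (∀ {a b c} → P a b c → P b a c) → (∀ a c → P a a c) →
  (∀ {i j k} → i ℕ.< j → j ℕ.< k → k ℕ.≤ m → P i j k) →
  ∀ {a b c} → a ℕ.≤ m → b ℕ.≤ m → c ℕ.≤ m → P a b c
on-all-triples m P cyc swap rep sorted {a} {b} {c} a≤m b≤m c≤m
  with ℕₚ.<-cmp a b | ℕₚ.<-cmp b c | ℕₚ.<-cmp a c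
... | tri≈ _ refl _ | _             | _             = rep a c
... | _             | tri≈ _ refl _ | _             = cyc (cyc (rep b a))
... | _             | _             | tri≈ _ refl _ = cyc (rep a b)
... | tri< a<b _ _  | tri< b<c _ _  | _             = sorted a<b b<c c≤m
... | tri< a<b _ _  | tri> _ _ c<b  | tri< a<c _ _  = cyc (swap (sorted a<c c<b b≤m))
... | tri< a<b _ _  | tri> _ _ c<b  | tri> _ _ c<a  = cyc (sorted c<a a<b b≤m)
... | tri> _ _ b<a  | tri< b<c _ _  | tri< a<c _ _  = swap (sorted b<a a<c c≤m)
... | tri> _ _ b<a  | tri< b<c _ _  | tri> _ _ c<a  = cyc (cyc (sorted b<c c<a a≤m))
... | tri> _ _ b<a  | tri> _ _ c<b  | _             = cyc (cyc (swap (sorted c<b b<a a≤m)))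

module _ {m : ℕ} (R : ConvexChain m) where
  open ConvexChain R

  private
    SideOK⇒≢0 : ∀ {s a b p} → SideOK s a b p → orient a b p ≢ 0ℚ
    SideOK⇒≢0 {plus}  h = ≢-sym (<⇒≢ h)
    SideOK⇒≢0 {minus} h = <⇒≢ h

  chain-orient≢0 : ∀ {a b c} → a ℕ.≤ m → b ℕ.≤ m → c ℕ.≤ m → a ≢ b → a ≢ c → b ≢ c →
    orient (point a) (point b) (point c) ≢ 0ℚ
  chain-orient≢0 = on-all-triples m Nondegenerate
    (λ {a} {b} {c} h b≢c b≢a c≢a eq → h (≢-sym b≢a) (≢-sym c≢a) b≢c
                                        (trans (orient-cyclic (point a) (point b) (point c)) eq))
    (λ {a} {b} {c} h b≢a b≢c a≢c eq → h (≢-sym b≢a) a≢c b≢c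
                                        (trans (orient-swap₁₂ (point a) (point b) (point c)) (cong -_ eq)))
    (λ a c a≢a _ _ → ⊥-elim (a≢a refl))
    (λ {i} {j} {k} i<j j<k k≤m _ _ _ eq → SideOK⇒≢0 (chord-side R i<j j<k k≤m)
                                            (trans (orient-swap₂₃ (point i) (point k) (point j)) (cong -_ eq)))
    where
    Nondegenerate : ℕ → ℕ → ℕ → Set
    Nondegenerate a b c = a ≢ b → a ≢ c → b ≢ c → orient (point a) (point b) (point c) ≢ 0ℚ

SideOK-swap : ∀ {s a b p} → SideOK s a b p → SideOK (neg s) b a p
SideOK-swap {plus}  {a} {b} {p} h = subst (_< 0ℚ) (sym (orient-swap₁₂ b a p)) (neg-antimono-< h)
SideOK-swap {minus} {a} {b} {p} h = subst (0ℚ <_) (sym (orient-swap₁₂ b a p)) (neg-antimono-< h)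

SideOK-opposite : ∀ {s a b p a' b' p'} → SideOK s a b p → SideOK (neg s) a' b' p' →
  SignReversed (orient a b p) (orient a' b' p')
SideOK-opposite {plus}  h h' = inj₁ (inj₁ (h , h'))
SideOK-opposite {minus} h h' = inj₁ (inj₂ (h , h'))

module _ {m : ℕ} (R R' : ConvexChain m) where
  private
    module R  = ConvexChain R
    module R' = ConvexChain R'

  chains-reversed : (f : ℕ → ℕ) →
    (∀ {i j k} → i ℕ.< j → j ℕ.< k → k ℕ.≤ m →
       SignReversed (orient (R.point i) (R.point k) (R.point j)) (orient (R'.point (f i)) (R'.point (f k)) (R'.point (f j)))) →
    ∀ {a b c} → a ℕ.≤ m → b ℕ.≤ m → c ℕ.≤ m →
    SignReversed (orient (R.point a) (R.point b) (R.point c)) (orient (R'.point (f a)) (R'.point (f b)) (R'.point (f c)))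
  chains-reversed f sorted = on-all-triples m Reversed
    (λ {a} {b} {c} → subst₂ SignReversed (orient-cyclic (p a) (p b) (p c)) (orient-cyclic (p' a) (p' b) (p' c)))
    (λ {a} {b} {c} h → subst₂ SignReversed (sym (orient-swap₁₂ (p b) (p a) (p c))) (sym (orient-swap₁₂ (p' b) (p' a) (p' c)))
                         (SignReversed-neg h))
    (λ a c → inj₂ (orient-repeat₁₂ (p a) (p c) , orient-repeat₁₂ (p' a) (p' c)))
    (λ {i} {j} {k} i<j j<k k≤m →
      subst₂ SignReversed (sym (orient-swap₂₃ (p i) (p j) (p k))) (sym (orient-swap₂₃ (p' i) (p' j) (p' k)))
        (SignReversed-neg (sorted i<j j<k k≤m)))
    where
    p = R.point
    p' = λ r → R'.point (f r)
    Reversed : ℕ → ℕ → ℕ → Set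
    Reversed a b c = SignReversed (orient (p a) (p b) (p c)) (orient (p' a) (p' b) (p' c))

  opposite-signs⇒chains-reversed : (∀ {j} → 0 ℕ.< j → j ℕ.< m → R'.sign j ≡ neg (R.sign j)) →
    ∀ {a b c} → a ℕ.≤ m → b ℕ.≤ m → c ℕ.≤ m →
    SignReversed (orient (R.point a) (R.point b) (R.point c)) (orient (R'.point a) (R'.point b) (R'.point c))
  opposite-signs⇒chains-reversed sign≡ = chains-reversed (λ r → r) λ {i} {j} i<j j<k k≤m →
    SideOK-opposite (chord-side R i<j j<k k≤m)
      (subst (λ s → SideOK s _ _ _) (sign≡ (ℕₚ.≤-<-trans z≤n i<j) (ℕₚ.<-≤-trans j<k k≤m))
        (chord-side R' i<j j<k k≤m))

  backward-signs⇒chains-reversed : (∀ {j} → 0 ℕ.< j → j ℕ.< m → R'.sign (m ∸ j) ≡ R.sign j) →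
    ∀ {a b c} → a ℕ.≤ m → b ℕ.≤ m → c ℕ.≤ m →
    SignReversed (orient (R.point a) (R.point b) (R.point c))
                 (orient (R'.point (m ∸ a)) (R'.point (m ∸ b)) (R'.point (m ∸ c)))
  backward-signs⇒chains-reversed sign≡ = chains-reversed (m ∸_) λ {i} {j} {k} i<j j<k k≤m →
    let j<m = ℕₚ.<-≤-trans j<k k≤m in
    SideOK-opposite (chord-side R i<j j<k k≤m)
      (SideOK-swap (subst (λ s → SideOK s _ _ _) (sign≡ (ℕₚ.≤-<-trans z≤n i<j) j<m)
        (chord-side R' (ℕₚ.∸-monoʳ-< j<k k≤m) (ℕₚ.∸-monoʳ-< i<j (ℕₚ.<⇒≤ j<m)) (ℕₚ.m∸n≤m m i))))

clamp : (n : ℕ) → ℕ → Fin (suc n)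
clamp n       zero    = Fin.zero
clamp zero    (suc k) = Fin.zero
clamp (suc n) (suc k) = Fin.suc (clamp n k)

toℕ-clamp : ∀ {n k} → k ℕ.≤ n → toℕ (clamp n k) ≡ k
toℕ-clamp {n}     {zero}  _         = refl
toℕ-clamp {suc n} {suc k} (s≤s k≤n) = cong suc (toℕ-clamp k≤n)

clamp-toℕ : ∀ {n} (i : Fin (suc n)) → clamp n (toℕ i) ≡ i
clamp-toℕ {n}     Fin.zero    = refl
clamp-toℕ {suc n} (Fin.suc i) = cong Fin.suc (clamp-toℕ i)

clamp-self : ∀ n → clamp n n ≡ fromℕ n
clamp-self zero    = refl
clamp-self (suc n) = cong Fin.suc (clamp-self n)

inject₁-clamp : ∀ {n k} → k ℕ.≤ n → inject₁ (clamp n k) ≡ clamp (suc n) k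
inject₁-clamp {n}     {zero}  _         = refl
inject₁-clamp {suc n} {suc k} (s≤s k≤n) = cong Fin.suc (inject₁-clamp k≤n)

opposite-clamp : ∀ {n k} → k ℕ.≤ n → opposite (clamp n (n ∸ k)) ≡ clamp n k
opposite-clamp {n} {k} k≤n = Finₚ.toℕ-injective (begin
  toℕ (opposite (clamp n (n ∸ k))) ≡⟨ Finₚ.opposite-prop (clamp n (n ∸ k)) ⟩
  n ∸ toℕ (clamp n (n ∸ k))        ≡⟨ cong (n ∸_) (toℕ-clamp (ℕₚ.m∸n≤m n k)) ⟩
  n ∸ (n ∸ k)                      ≡⟨ ℕₚ.m∸[m∸n]≡n k≤n ⟩
  k                                ≡⟨ toℕ-clamp k≤n ⟨
  toℕ (clamp n k)                  ∎)
  where open ≡-Reasoning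

halve : ℕ → ℕ × Bool
halve zero    = 0 , false
halve (suc r) with halve r
... | k , false = k , true
... | k , true  = suc k , false

halve-even : ∀ k → halve (k ℕ.+ k) ≡ (k , false)
halve-even zero = refl
halve-even (suc k) rewrite ℕₚ.+-suc k k | halve-even k = refl

halve-odd : ∀ k → halve (suc (k ℕ.+ k)) ≡ (k , true)
halve-odd k rewrite halve-even k = refl

parity : ∀ r → ∃ λ k → r ≡ k ℕ.+ k ⊎ r ≡ suc (k ℕ.+ k)
parity zero = 0 , inj₁ refl
parity (suc r) with parity r
... | k , inj₁ refl = k , inj₂ refl
... | k , inj₂ refl = suc k , inj₁ (cong suc (sym (ℕₚ.+-suc k k)))

half-bound : ∀ {k n} → k ℕ.+ k ℕ.≤ suc (n ℕ.+ n) → k ℕ.≤ n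
half-bound {zero}          _ = z≤n
half-bound {suc k} {zero}  (s≤s h) rewrite ℕₚ.+-suc k k with h
... | ()
half-bound {suc k} {suc n} (s≤s h) rewrite ℕₚ.+-suc k k | ℕₚ.+-suc n n = s≤s (half-bound (ℕₚ.≤-pred h))

double-∸ : ∀ {b n} → b ℕ.≤ n → (n ℕ.+ n) ∸ (b ℕ.+ b) ≡ (n ∸ b) ℕ.+ (n ∸ b)
double-∸ {b} {n} b≤n = begin
  (n ℕ.+ n) ∸ (b ℕ.+ b)                  ≡⟨ cong (λ x → (x ℕ.+ x) ∸ (b ℕ.+ b)) (ℕₚ.m∸n+n≡m b≤n) ⟨
  ((d ℕ.+ b) ℕ.+ (d ℕ.+ b)) ∸ (b ℕ.+ b)  ≡⟨ cong (_∸ (b ℕ.+ b)) (rearrange d b) ⟩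
  (d ℕ.+ d) ℕ.+ (b ℕ.+ b) ∸ (b ℕ.+ b)    ≡⟨ ℕₚ.m+n∸n≡m (d ℕ.+ d) (b ℕ.+ b) ⟩
  d ℕ.+ d                                ∎
  where
  open ≡-Reasoning
  d = n ∸ b
  rearrange : ∀ d b → (d ℕ.+ b) ℕ.+ (d ℕ.+ b) ≡ (d ℕ.+ d) ℕ.+ (b ℕ.+ b)
  rearrange = solve-∀

module Ranks (n' : ℕ) where
  n : ℕ
  n = suc n'

  m : ℕ
  m = suc (n ℕ.+ n)

  rank : Vertex n → ℕ
  rank (inj₁ b) = toℕ b ℕ.+ toℕ b
  rank (inj₂ w) = suc (toℕ w ℕ.+ toℕ w)

  private
    fromHalf : ℕ × Bool → Vertex n
    fromHalf (k , false) = inj₁ (clamp n k)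
    fromHalf (k , true)  = inj₂ (clamp n k)

  vertexAt : ℕ → Vertex n
  vertexAt r = fromHalf (halve r)

  vertexAt-even : ∀ k → vertexAt (k ℕ.+ k) ≡ inj₁ (clamp n k)
  vertexAt-even k = cong fromHalf (halve-even k)

  vertexAt-odd : ∀ k → vertexAt (suc (k ℕ.+ k)) ≡ inj₂ (clamp n k)
  vertexAt-odd k = cong fromHalf (halve-odd k)

  vertexAt-rank : ∀ v → vertexAt (rank v) ≡ v
  vertexAt-rank (inj₁ b) = trans (vertexAt-even (toℕ b)) (cong inj₁ (clamp-toℕ b))
  vertexAt-rank (inj₂ w) = trans (vertexAt-odd (toℕ w)) (cong inj₂ (clamp-toℕ w))

  rank-vertexAt : ∀ {r} → r ℕ.≤ m → rank (vertexAt r) ≡ r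
  rank-vertexAt {r} r≤m with parity r
  ... | k , inj₁ refl rewrite vertexAt-even k | toℕ-clamp (half-bound {k} {n} r≤m) = refl
  ... | k , inj₂ refl rewrite vertexAt-odd k
                            | toℕ-clamp (half-bound {k} {n} (ℕₚ.≤-trans (ℕₚ.n≤1+n _) r≤m)) = refl

  rank≤m : ∀ v → rank v ℕ.≤ m
  rank≤m (inj₁ b) = ℕₚ.≤-trans (ℕₚ.+-mono-≤ (Finₚ.toℕ≤pred[n] b) (Finₚ.toℕ≤pred[n] b)) (ℕₚ.n≤1+n _)
  rank≤m (inj₂ w) = s≤s (ℕₚ.+-mono-≤ (Finₚ.toℕ≤pred[n] w) (Finₚ.toℕ≤pred[n] w))

  vertexAt-injective : ∀ {a b} → a ℕ.≤ m → b ℕ.≤ m → a ≢ b → vertexAt a ≢ vertexAt b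
  vertexAt-injective a≤m b≤m a≢b eq =
    a≢b (trans (sym (rank-vertexAt a≤m)) (trans (cong rank eq) (rank-vertexAt b≤m)))

  interior-half : ∀ {k} → suc (k ℕ.+ k) ℕ.< m → k ℕ.≤ n'
  interior-half {k} h = half-bound (subst (k ℕ.+ k ℕ.≤_) (ℕₚ.+-suc n' n') (ℕₚ.≤-pred (ℕₚ.≤-pred h)))

  flipVertex : Vertex n → Vertex n
  flipVertex (inj₁ b) = inj₂ (opposite b)
  flipVertex (inj₂ w) = inj₁ (opposite w)

  flipVertex-involutive : ∀ v → flipVertex (flipVertex v) ≡ v
  flipVertex-involutive (inj₁ b) = cong inj₁ (Finₚ.opposite-involutive b)
  flipVertex-involutive (inj₂ w) = cong inj₂ (Finₚ.opposite-involutive w)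

  rank-flip : ∀ v → rank (flipVertex v) ≡ m ∸ rank v
  rank-flip (inj₁ b) rewrite Finₚ.opposite-prop b =
    sym (trans (ℕₚ.+-∸-assoc 1 (ℕₚ.+-mono-≤ b≤n b≤n)) (cong suc (double-∸ b≤n)))
    where b≤n = Finₚ.toℕ≤pred[n] b
  rank-flip (inj₂ w) rewrite Finₚ.opposite-prop w = sym (double-∸ (Finₚ.toℕ≤pred[n] w))

  vertexAt-∸ : ∀ {j} → j ℕ.≤ m → vertexAt (m ∸ j) ≡ flipVertex (vertexAt j)
  vertexAt-∸ {j} j≤m = begin
    vertexAt (m ∸ j)                           ≡⟨ cong (λ r → vertexAt (m ∸ r)) (rank-vertexAt j≤m) ⟨
    vertexAt (m ∸ rank (vertexAt j))           ≡⟨ cong vertexAt (rank-flip (vertexAt j)) ⟨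
    vertexAt (rank (flipVertex (vertexAt j)))  ≡⟨ vertexAt-rank (flipVertex (vertexAt j)) ⟩
    flipVertex (vertexAt j)                    ∎
    where open ≡-Reasoning

  -- The vertices k_• and k_∘ have sign ε_k, stored at index k - 1; the two ends 0_• and (n+1)_∘
  -- carry no sign and get a clamped junk index.
  signIndex : Vertex n → Fin n
  signIndex (inj₁ b) = clamp n' (ℕ.pred (toℕ b))
  signIndex (inj₂ w) = clamp n' (toℕ w)

  signIndex-flip : ∀ v → 0 ℕ.< rank v → rank v ℕ.< m → opposite (signIndex (flipVertex v)) ≡ signIndex v
  signIndex-flip (inj₁ (Fin.suc b)) _ _ =
    trans (cong (λ x → opposite (clamp n' x)) (Finₚ.opposite-prop (Fin.suc b)))
          (opposite-clamp (Finₚ.toℕ≤pred[n] b))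
  signIndex-flip (inj₂ w) _ w<m =
    trans (cong (λ x → opposite (clamp n' (ℕ.pred x)))
                (trans (Finₚ.opposite-prop w) (ℕₚ.+-∸-assoc 1 w≤n')))
          (opposite-clamp w≤n')
    where
    w≤n' : toℕ w ℕ.≤ n'
    w≤n' = interior-half w<m

position : ∀ {n ε} → Polygon n ε → Vertex n → Point
position P = vpos (Polygon.black P) (Polygon.white P)

module _ {n' : ℕ} {ε : Signature (suc n')} (P : Polygon (suc n') ε) where
  open Ranks n'
  open Polygon P

  private
    point : ℕ → Point
    point r = position P (vertexAt r)

    point-m : point m ≡ white (fromℕ n)
    point-m = cong (position P) (trans (vertexAt-odd n) (cong inj₂ (clamp-self n)))

    side-at : ∀ {j v} → vertexAt j ≡ v →
      SideOK (ε (signIndex v)) (black Fin.zero) (white (fromℕ n)) (position P v) →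
      SideOK (ε (signIndex (vertexAt j))) (point 0) (point m) (point j)
    side-at {j} refl h = subst (λ q → SideOK (ε (signIndex (vertexAt j))) (black Fin.zero) q (point j)) (sym point-m) h

  polygon-x-increasing : ∀ r → suc r ℕ.≤ m → xc (point r) < xc (point (suc r))
  polygon-x-increasing r r<m with parity r
  ... | k , inj₁ refl = subst₂ (λ u v → xc (position P u) < xc (position P v))
                          (sym (vertexAt-even k)) (sym (vertexAt-odd k)) (xorder₁ (clamp n k))
  ... | k , inj₂ refl = subst₂ (λ u v → xc (position P u) < xc (position P v))
                          (trans (cong inj₂ (inject₁-clamp (interior-half r<m))) (sym (vertexAt-odd k)))
                          (trans (sym (vertexAt-even (suc k))) (cong vertexAt (cong suc (ℕₚ.+-suc k k))))
                          (xorder₂ (clamp n' k))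

  polygon-side : ∀ j → 0 ℕ.< j → j ℕ.< m → SideOK (ε (signIndex (vertexAt j))) (point 0) (point m) (point j)
  polygon-side j 0<j j<m with parity j
  ... | zero  , inj₁ refl = ⊥-elim (ℕₚ.<-irrefl refl 0<j)
  ... | suc k , inj₁ refl = side-at {suc k ℕ.+ suc k} (vertexAt-even (suc k))
                              (subst (λ i → SideOK (ε i) (black Fin.zero) (white (fromℕ n)) (black (Fin.suc (clamp n' k))))
                                 (sym (clamp-toℕ (clamp n' k))) (sideB (clamp n' k)))
  ... | k     , inj₂ refl = side-at {suc (k ℕ.+ k)} (vertexAt-odd k)
                              (subst₂ (λ i v → SideOK (ε i) (black Fin.zero) (white (fromℕ n)) (white v))
                                 (cong (clamp n') (sym (toℕ-clamp (ℕₚ.≤-trans k≤n' (ℕₚ.n≤1+n n')))))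
                                 (inject₁-clamp k≤n')
                                 (sideW (clamp n' k)))
    where
    k≤n' = interior-half j<m

  polygonChain : ConvexChain m
  polygonChain = record
    { point        = point
    ; sign         = λ r → ε (signIndex (vertexAt r))
    ; x-increasing = polygon-x-increasing
    ; side         = polygon-side
    ; convex       = λ a b c d a≤m b≤m c≤m d≤m a≢b a≢c a≢d b≢c b≢d c≢d →
        convex (vertexAt a) (vertexAt b) (vertexAt c) (vertexAt d)
          (vertexAt-injective a≤m b≤m a≢b) (vertexAt-injective a≤m c≤m a≢c) (vertexAt-injective a≤m d≤m a≢d)
          (vertexAt-injective b≤m c≤m b≢c) (vertexAt-injective b≤m d≤m b≢d) (vertexAt-injective c≤m d≤m c≢d)
    }

module _ {n' : ℕ} where
  open Ranks n'

  private
    chainPoint-rank : ∀ {ε} (P : Polygon (suc n') ε) v → ConvexChain.point (polygonChain P) (rank v) ≡ position P v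
    chainPoint-rank P v = cong (position P) (vertexAt-rank v)

    chainPoint-flip : ∀ {ε} (P : Polygon (suc n') ε) v →
      ConvexChain.point (polygonChain P) (m ∸ rank v) ≡ position P (flipVertex v)
    chainPoint-flip P v = cong (position P) (trans (cong vertexAt (sym (rank-flip v))) (vertexAt-rank (flipVertex v)))

    rank-injective : ∀ {u v} → u ≢ v → rank u ≢ rank v
    rank-injective u≢v eq = u≢v (trans (sym (vertexAt-rank _)) (trans (cong vertexAt eq) (vertexAt-rank _)))

  polygon-orient≢0 : ∀ {ε} (P : Polygon (suc n') ε) {u v w} → u ≢ v → u ≢ w → v ≢ w →
    orient (position P u) (position P v) (position P w) ≢ 0ℚ
  polygon-orient≢0 P {u} {v} {w} u≢v u≢w v≢w eq =
    chain-orient≢0 (polygonChain P) (rank≤m u) (rank≤m v) (rank≤m w)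
      (rank-injective u≢v) (rank-injective u≢w) (rank-injective v≢w)
      (trans (orient-cong (chainPoint-rank P u) (chainPoint-rank P v) (chainPoint-rank P w)) eq)

  negated-polygons-reversed : ∀ {ε} (P : Polygon (suc n') ε) (P' : Polygon (suc n') (negSig ε)) →
    ReversedOrientations (position P) (position P')
  negated-polygons-reversed P P' u v w =
    subst₂ SignReversed
      (orient-cong (chainPoint-rank P u) (chainPoint-rank P v) (chainPoint-rank P w))
      (orient-cong (chainPoint-rank P' u) (chainPoint-rank P' v) (chainPoint-rank P' w))
      (opposite-signs⇒chains-reversed (polygonChain P) (polygonChain P') (λ _ _ → refl)
        (rank≤m u) (rank≤m v) (rank≤m w))

  flipped-polygons-reversed : ∀ {ε} (P : Polygon (suc n') ε) (P' : Polygon (suc n') (barSig ε)) →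
    ReversedOrientations (position P) (λ v → position P' (flipVertex v))
  flipped-polygons-reversed {ε} P P' u v w =
    subst₂ SignReversed
      (orient-cong (chainPoint-rank P u) (chainPoint-rank P v) (chainPoint-rank P w))
      (orient-cong (chainPoint-flip P' u) (chainPoint-flip P' v) (chainPoint-flip P' w))
      (backward-signs⇒chains-reversed (polygonChain P) (polygonChain P') sign-flip
        (rank≤m u) (rank≤m v) (rank≤m w))
    where
    sign-flip : ∀ {j} → 0 ℕ.< j → j ℕ.< m → ε (opposite (signIndex (vertexAt (m ∸ j)))) ≡ ε (signIndex (vertexAt j))
    sign-flip {j} 0<j j<m = cong ε (trans (cong (λ x → opposite (signIndex x)) (vertexAt-∸ (ℕₚ.<⇒≤ j<m)))
      (signIndex-flip (vertexAt j) (subst (0 ℕ.<_) (sym (rank-vertexAt (ℕₚ.<⇒≤ j<m))) 0<j)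
                                    (subst (ℕ._< m) (sym (rank-vertexAt (ℕₚ.<⇒≤ j<m))) j<m)))

Edge : ℕ → Set
Edge n = Fin (suc n) × Fin (suc n)

_≟ₑ_ : ∀ {n} (e e' : Edge n) → Dec (e ≡ e')
_≟ₑ_ = Productₚ.≡-dec Fin._≟_ Fin._≟_

edgeAt : ∀ {n} → EdgeSet n → Edge n → Bool
edgeAt E (b , w) = lookup (lookup E b) w

_∋_ : ∀ {n} → EdgeSet n → Edge n → Set
E ∋ e = edgeAt E e ≡ true

setEdge : ∀ {n} → EdgeSet n → Edge n → Bool → EdgeSet n
setEdge E (b , w) x = updateAt E b (λ row → row [ w ]≔ x)

Vec-ext : ∀ {A : Set} {k} (xs ys : Vec A k) → (∀ i → lookup xs i ≡ lookup ys i) → xs ≡ ys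
Vec-ext xs ys h = trans (sym (Vecₚ.tabulate∘lookup xs)) (trans (Vecₚ.tabulate-cong h) (Vecₚ.tabulate∘lookup ys))

EdgeSet-ext : ∀ {n} {E E' : EdgeSet n} → (∀ e → edgeAt E e ≡ edgeAt E' e) → E ≡ E'
EdgeSet-ext {E = E} {E'} h = Vec-ext E E' λ b → Vec-ext (lookup E b) (lookup E' b) λ w → h (b , w)

edgeAt-set-same : ∀ {n} (E : EdgeSet n) e x → edgeAt (setEdge E e x) e ≡ x
edgeAt-set-same E (b , w) x =
  trans (cong (λ row → lookup row w) (Vecₚ.lookup∘updateAt b E)) (Vecₚ.lookup∘update w (lookup E b) x)

edgeAt-set-other : ∀ {n} (E : EdgeSet n) {e e'} x → e' ≢ e → edgeAt (setEdge E e x) e' ≡ edgeAt E e'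
edgeAt-set-other E {b , w} {b' , w'} x e'≢e with b' Fin.≟ b
... | yes refl = trans (cong (λ row → lookup row w') (Vecₚ.lookup∘updateAt b E))
                       (Vecₚ.lookup∘update′ (λ w'≡w → e'≢e (cong (b ,_) w'≡w)) (lookup E b) x)
... | no b'≢b  = cong (λ row → lookup row w') (Vecₚ.lookup∘updateAt′ b' b b'≢b E)

relabel : ∀ {n} → (Edge n → Edge n) → EdgeSet n → EdgeSet n
relabel τ E = tabulate (λ b → tabulate (λ w → edgeAt E (τ (b , w))))

edgeAt-relabel : ∀ {n} τ (E : EdgeSet n) e → edgeAt (relabel τ E) e ≡ edgeAt E (τ e)
edgeAt-relabel τ E (b , w) =
  trans (cong (λ row → lookup row w) (Vecₚ.lookup∘tabulate (λ b → tabulate (λ w → edgeAt E (τ (b , w)))) b))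
        (Vecₚ.lookup∘tabulate (λ w → edgeAt E (τ (b , w))) w)

relabel-∋⁻ : ∀ {n} τ (E : EdgeSet n) e → relabel τ E ∋ e → E ∋ τ e
relabel-∋⁻ τ E e h = trans (sym (edgeAt-relabel τ E e)) h

module _ {n : ℕ} (τ : Edge n → Edge n) (τ-involutive : ∀ e → τ (τ e) ≡ e) where

  relabel-∋ : ∀ E e → E ∋ e → relabel τ E ∋ τ e
  relabel-∋ E e h = trans (edgeAt-relabel τ E (τ e)) (subst (E ∋_) (sym (τ-involutive e)) h)

  τ-injective : ∀ {e e'} → τ e ≡ τ e' → e ≡ e'
  τ-injective {e} {e'} eq = trans (sym (τ-involutive e)) (trans (cong τ eq) (τ-involutive e'))

  relabel-involutive : ∀ E → relabel τ (relabel τ E) ≡ E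
  relabel-involutive E = EdgeSet-ext λ e →
    trans (edgeAt-relabel τ (relabel τ E) e) (trans (edgeAt-relabel τ E (τ e)) (cong (edgeAt E) (τ-involutive e)))

  relabel-injective : ∀ {E E'} → relabel τ E ≡ relabel τ E' → E ≡ E'
  relabel-injective {E} {E'} eq =
    trans (sym (relabel-involutive E)) (trans (cong (relabel τ) eq) (relabel-involutive E'))

  relabel-set : ∀ E e x → relabel τ (setEdge E e x) ≡ setEdge (relabel τ E) (τ e) x
  relabel-set E e x = EdgeSet-ext at
    where
    at : ∀ e' → edgeAt (relabel τ (setEdge E e x)) e' ≡ edgeAt (setEdge (relabel τ E) (τ e) x) e'
    at e' with e' ≟ₑ τ e
    ... | yes refl = trans (edgeAt-relabel τ (setEdge E e x) (τ e))
                       (trans (cong (edgeAt (setEdge E e x)) (τ-involutive e))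
                         (trans (edgeAt-set-same E e x) (sym (edgeAt-set-same (relabel τ E) (τ e) x))))
    ... | no e'≢τe = trans (edgeAt-relabel τ (setEdge E e x) e')
                       (trans (edgeAt-set-other E x (λ τe'≡e → e'≢τe (trans (sym (τ-involutive e')) (cong τ τe'≡e))))
                         (trans (sym (edgeAt-relabel τ E e')) (sym (edgeAt-set-other (relabel τ E) x e'≢τe))))

Crosses : ∀ {n ε} → Polygon n ε → Edge n → Edge n → Set
Crosses P (b , w) (b' , w') = SegCross (Polygon.black P b) (Polygon.white P w) (Polygon.black P b') (Polygon.white P w')

Crosses-sym : ∀ {n ε} (P : Polygon n ε) {e e'} → Crosses P e e' → Crosses P e' e
Crosses-sym P {b , w} {b' , w'} = SegCross-sym {Polygon.black P b} {Polygon.white P w} {Polygon.black P b'} {Polygon.white P w'}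

⊆ₑ-insert : ∀ {n} (E : EdgeSet n) e → E ⊆ₑ setEdge E e true
⊆ₑ-insert E e b w h with (b , w) ≟ₑ e
... | yes refl = edgeAt-set-same E e true
... | no f≢e   = trans (edgeAt-set-other E true f≢e) h

insert-noncrossing : ∀ {n ε} (P : Polygon n ε) {I J E e} → NonCrossingSet P I J E → IsEdgeG I J (proj₁ e) (proj₂ e) →
  (∀ {f} → E ∋ f → f ≢ e → ¬ Crosses P e f) → NonCrossingSet P I J (setEdge E e true)
insert-noncrossing P {I} {J} {E} {e} (edges , noncrossing) e-edge e-free = edges⁺ , noncrossing⁺
  where
  old : ∀ {f} → setEdge E e true ∋ f → f ≢ e → E ∋ f
  old {f} h f≢e = trans (sym (edgeAt-set-other E true f≢e)) h

  edges⁺ : ∀ b w → setEdge E e true ∋ (b , w) → IsEdgeG I J b w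
  edges⁺ b w h with (b , w) ≟ₑ e
  ... | yes refl = e-edge
  ... | no f≢e   = edges b w (old h f≢e)

  noncrossing⁺ : ∀ b w b' w' → setEdge E e true ∋ (b , w) → setEdge E e true ∋ (b' , w') → (b , w) ≢ (b' , w') →
    ¬ Crosses P (b , w) (b' , w')
  noncrossing⁺ b w b' w' h h' f≢g with (b , w) ≟ₑ e | (b' , w') ≟ₑ e
  ... | yes refl | yes refl = ⊥-elim (f≢g refl)
  ... | yes refl | no g≢e   = e-free (old h' g≢e) g≢e
  ... | no f≢e   | yes refl = λ c → e-free (old h f≢e) f≢e (Crosses-sym P c)
  ... | no f≢e   | no g≢e   = noncrossing b w b' w' (old h f≢e) (old h' g≢e) f≢g

module _ {n' : ℕ} {ε : Signature (suc n')} (P : Polygon (suc n') ε) where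
  open Polygon P using (black; white)

  EndsCross : Edge (suc n') → Edge (suc n') → Set
  EndsCross (b , w) (b' , w') = Crossing (black b) (white w) (black b') (white w')

  private
    separated-ends : ∀ {b w b' w'} → (b , w) ≢ (b' , w') →
      orient (black b) (white w) (black b') ≢ 0ℚ ⊎ orient (black b) (white w) (white w') ≢ 0ℚ
    separated-ends {b} {w} {b'} {w'} e≢e' with b Fin.≟ b'
    ... | no b≢b'  = inj₁ (polygon-orient≢0 P {inj₁ b} {inj₂ w} {inj₁ b'} (λ ()) (λ { refl → b≢b' refl }) (λ ()))
    ... | yes refl = inj₂ (polygon-orient≢0 P {inj₁ b} {inj₂ w} {inj₂ w'} (λ ()) (λ ()) (λ { refl → e≢e' refl }))

  crosses⇒crossing : ∀ {e e'} → e ≢ e' → Crosses P e e' → EndsCross e e'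
  crosses⇒crossing {b , w} {b' , w'} e≢e' c =
    segCross⇒separates (black b) (white w) (black b') (white w') c (separated-ends e≢e') ,
    segCross⇒separates (black b') (white w') (black b) (white w)
      (Crosses-sym P c) (separated-ends (λ e'≡e → e≢e' (sym e'≡e)))

  crosses? : ∀ {e e'} → e ≢ e' → Dec (Crosses P e e')
  crosses? {b , w} {b' , w'} e≢e'
    with oppositeSigns? (orient (black b) (white w) (black b')) (orient (black b) (white w) (white w'))
       | oppositeSigns? (orient (black b') (white w') (black b)) (orient (black b') (white w') (white w))
  ... | yes ab | yes cd = yes (crossing⇒segCross (black b) (white w) (black b') (white w') (ab , cd))
  ... | no ¬ab | _      = no λ c → ¬ab (proj₁ (crosses⇒crossing e≢e' c))
  ... | yes _  | no ¬cd = no λ c → ¬cd (proj₂ (crosses⇒crossing e≢e' c))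

  -- If the exchanged edges did not cross, adding e' to T would keep it non-crossing,
  -- so e' would already lie in the maximal set T.
  flip-crosses : ∀ {I J T T' e e'} → IsTree P I J T → IsTree P I J T' → T ∋ e → T' ∋ e' →
    setEdge T e false ≡ setEdge T' e' false → T ≢ T' → e ≢ e' × Crosses P e e'
  flip-crosses {I} {J} {T} {T'} {e} {e'} (ncT , maxT) (ncT' , _) T∋e T'∋e' T∖e≡T'∖e' T≢T' = e≢e' , crossing
    where
    at-removed : ∀ {f} → f ≢ e → f ≢ e' → edgeAt T f ≡ edgeAt T' f
    at-removed f≢e f≢e' = trans (sym (edgeAt-set-other T false f≢e))
      (trans (cong (λ E → edgeAt E _) T∖e≡T'∖e') (edgeAt-set-other T' false f≢e'))

    e≢e' : e ≢ e'
    e≢e' refl = T≢T' (EdgeSet-ext agree)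
      where
      agree : ∀ f → edgeAt T f ≡ edgeAt T' f
      agree f with f ≟ₑ e
      ... | yes refl = trans T∋e (sym T'∋e')
      ... | no f≢e   = at-removed f≢e f≢e

    e'∉T : ¬ T ∋ e'
    e'∉T h with trans (sym h) (trans (sym (edgeAt-set-other T false (λ e'≡e → e≢e' (sym e'≡e))))
                  (trans (cong (λ E → edgeAt E e') T∖e≡T'∖e') (edgeAt-set-same T' e' false)))
    ... | ()

    crossing : Crosses P e e'
    crossing with crosses? e≢e'
    ... | yes c = c
    ... | no ¬c = ⊥-elim (e'∉T (maxT (setEdge T e' true) (⊆ₑ-insert T e')
                                   (insert-noncrossing P {E = T} ncT (proj₁ ncT' (proj₁ e') (proj₂ e') T'∋e') e'-free)
                                   (proj₁ e') (proj₂ e') (edgeAt-set-same T e' true)))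
      where
      e'-free : ∀ {f} → T ∋ f → f ≢ e' → ¬ Crosses P e' f
      e'-free {f} T∋f f≢e' with f ≟ₑ e
      ... | yes refl = λ c → ¬c (Crosses-sym P c)
      ... | no f≢e   = proj₂ ncT' (proj₁ e') (proj₂ e') (proj₁ f) (proj₂ f) T'∋e'
                         (trans (sym (at-removed f≢e f≢e')) T∋f) (λ e'≡f → f≢e' (sym e'≡f))

IsEdge : ∀ {n} → Subset (suc n) → Subset (suc n) → Edge n → Set
IsEdge I J (b , w) = IsEdgeG I J b w

SlopeBelow : ∀ {n ε} → Polygon n ε → Edge n → Edge n → Set
SlopeBelow P (b , w) (b' , w') = LeftTurn (Polygon.black P b) (Polygon.white P w) (Polygon.black P b') (Polygon.white P w')

record FlipReversing {n ε ε'} (P : Polygon n ε) (I J : Subset (suc n)) (P' : Polygon n ε') (I' J' : Subset (suc n))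
                     (τ : Edge n → Edge n) : Set where
  field
    edge  : ∀ {e} → IsEdge I J e → IsEdge I' J' (τ e)
    cross : ∀ {e e'} → e ≢ e' → Crosses P e e' → Crosses P' (τ e) (τ e')
    slope : ∀ {e e'} → e ≢ e' → Crosses P e e' → SlopeBelow P e e' → SlopeBelow P' (τ e') (τ e)

module _ {n' : ℕ} {ε ε' : Signature (suc n')} {P : Polygon (suc n') ε} {P' : Polygon (suc n') ε'}
         {I J I' J' : Subset (suc (suc n'))} (τ : Edge (suc n') → Edge (suc n'))
         (τ-involutive : ∀ e → τ (τ e) ≡ e)
         (r : FlipReversing P I J P' I' J' τ) (r' : FlipReversing P' I' J' P I J τ) where
  private
    module r  = FlipReversing r
    module r' = FlipReversing r'

  relabel-noncrossing : ∀ E → NonCrossingSet P I J E → NonCrossingSet P' I' J' (relabel τ E)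
  relabel-noncrossing E (edges , noncrossing) =
    (λ b w h → subst (IsEdge I' J') (τ-involutive (b , w))
                 (r.edge (edges (proj₁ (τ (b , w))) (proj₂ (τ (b , w))) (relabel-∋⁻ τ E (b , w) h)))) ,
    (λ b w b' w' h h' f≢f' c →
      noncrossing (proj₁ (τ (b , w))) (proj₂ (τ (b , w))) (proj₁ (τ (b' , w'))) (proj₂ (τ (b' , w')))
        (relabel-∋⁻ τ E (b , w) h) (relabel-∋⁻ τ E (b' , w') h') (λ eq → f≢f' (τ-injective τ τ-involutive eq)) (r'.cross f≢f' c))

module _ {n' : ℕ} {ε ε' : Signature (suc n')} {P : Polygon (suc n') ε} {P' : Polygon (suc n') ε'}
         {I J I' J' : Subset (suc (suc n'))} (τ : Edge (suc n') → Edge (suc n'))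
         (τ-involutive : ∀ e → τ (τ e) ≡ e)
         (r : FlipReversing P I J P' I' J' τ) (r' : FlipReversing P' I' J' P I J τ) where
  private
    module r = FlipReversing r

  relabel-tree : ∀ T → IsTree P I J T → IsTree P' I' J' (relabel τ T)
  relabel-tree T (ncT , maxT) = relabel-noncrossing τ τ-involutive r r' T ncT , maximal
    where
    maximal : ∀ E' → relabel τ T ⊆ₑ E' → NonCrossingSet P' I' J' E' → E' ⊆ₑ relabel τ T
    maximal E' T̃⊆E' ncE' b w h =
      trans (edgeAt-relabel τ T (b , w))
        (maxT (relabel τ E') T⊆Ẽ' (relabel-noncrossing τ τ-involutive r' r E' ncE')
          (proj₁ (τ (b , w))) (proj₂ (τ (b , w))) (relabel-∋ τ τ-involutive E' (b , w) h))
      where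
      T⊆Ẽ' : T ⊆ₑ relabel τ E'
      T⊆Ẽ' b w h = trans (edgeAt-relabel τ E' (b , w))
        (T̃⊆E' (proj₁ (τ (b , w))) (proj₂ (τ (b , w))) (relabel-∋ τ τ-involutive T (b , w) h))

  relabel-flip : ∀ T T' → IsTree P I J T → IsTree P I J T' → IncFlip P I J T T' →
    IncFlip P' I' J' (relabel τ T') (relabel τ T)
  relabel-flip T T' treeT treeT' (b , w , b' , w' , T∋e , T'∋e' , T∖e≡T'∖e' , T≢T' , e<e') =
    proj₁ (τ e') , proj₂ (τ e') , proj₁ (τ e) , proj₂ (τ e) ,
    relabel-∋ τ τ-involutive T' e' T'∋e' , relabel-∋ τ τ-involutive T e T∋e ,
    (begin
      setEdge (relabel τ T') (τ e') false  ≡⟨ relabel-set τ τ-involutive T' e' false ⟨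
      relabel τ (setEdge T' e' false)      ≡⟨ cong (relabel τ) T∖e≡T'∖e' ⟨
      relabel τ (setEdge T e false)        ≡⟨ relabel-set τ τ-involutive T e false ⟩
      setEdge (relabel τ T) (τ e) false    ∎) ,
    (λ eq → T≢T' (sym (relabel-injective τ τ-involutive eq))) ,
    r.slope e≢e' crossing e<e'
    where
    open ≡-Reasoning
    e = (b , w)
    e' = (b' , w')
    flipped = flip-crosses P treeT treeT' T∋e T'∋e' T∖e≡T'∖e' T≢T'
    e≢e' = proj₁ flipped
    crossing = proj₂ flipped

relabel-antiIso : ∀ {n'} {ε ε' : Signature (suc n')} {P : Polygon (suc n') ε} {P' : Polygon (suc n') ε'}
  {I J I' J' : Subset (suc (suc n'))} (τ : Edge (suc n') → Edge (suc n')) (τ-involutive : ∀ e → τ (τ e) ≡ e) →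
  FlipReversing P I J P' I' J' τ → FlipReversing P' I' J' P I J τ →
  DiIso (IncFlipGraph P I J) (opG (IncFlipGraph P' I' J'))
relabel-antiIso {P = P} {I = I} {J} τ τ-involutive r r' = record
  { to       = relabel τ
  ; from     = relabel τ
  ; to-vtx   = relabel-tree τ τ-involutive r r'
  ; from-vtx = relabel-tree τ τ-involutive r' r
  ; from∘to  = λ T _ → relabel-involutive τ τ-involutive T
  ; to∘from  = λ T _ → relabel-involutive τ τ-involutive T
  ; arc-to   = relabel-flip τ τ-involutive r r'
  ; arc-from = λ T T' treeT treeT' flip →
      subst₂ (IncFlip P I J) (relabel-involutive τ τ-involutive T) (relabel-involutive τ τ-involutive T')
        (relabel-flip τ τ-involutive r' r (relabel τ T') (relabel τ T)
          (relabel-tree τ τ-involutive r r' T' treeT') (relabel-tree τ τ-involutive r r' T treeT) flip)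
  }

flipEdge : ∀ {n} → Edge n → Edge n
flipEdge (b , w) = opposite w , opposite b

flipEdge-involutive : ∀ {n} (e : Edge n) → flipEdge (flipEdge e) ≡ e
flipEdge-involutive (b , w) = cong₂ _,_ (Finₚ.opposite-involutive b) (Finₚ.opposite-involutive w)

∈barSet : ∀ {n} {S : Subset (suc n)} {i} → opposite i ∈ S → i ∈ barSet S
∈barSet {S = S} {i} h =
  Vecₚ.lookup⇒[]= i (barSet S) (trans (Vecₚ.lookup∘tabulate (λ k → lookup S (opposite k)) i) (Vecₚ.[]=⇒lookup h))

∈barSet⁻ : ∀ {n} {S : Subset (suc n)} {i} → i ∈ barSet S → opposite i ∈ S
∈barSet⁻ {S = S} {i} h =
  Vecₚ.lookup⇒[]= (opposite i) S (trans (sym (Vecₚ.lookup∘tabulate (λ k → lookup S (opposite k)) i)) (Vecₚ.[]=⇒lookup h))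

opposite-edge-index : ∀ {n} {b w : Fin (suc n)} → toℕ b ℕ.< suc (toℕ w) → toℕ (opposite w) ℕ.< suc (toℕ (opposite b))
opposite-edge-index {n} {b} {w} (s≤s b≤w)
  rewrite Finₚ.opposite-prop b | Finₚ.opposite-prop w = s≤s (ℕₚ.∸-monoʳ-≤ n b≤w)

IsEdge-flip : ∀ {n} {I J : Subset (suc n)} {e} → IsEdge I J e → IsEdge (barSet J) (barSet I) (flipEdge e)
IsEdge-flip {J = J} {e = b , w} (b∈I , w∈J , b<w) =
  ∈barSet (subst (_∈ J) (sym (Finₚ.opposite-involutive w)) w∈J) ,
  ∈barSet (subst (_∈ _) (sym (Finₚ.opposite-involutive b)) b∈I) ,
  opposite-edge-index b<w

IsEdge-flip⁻ : ∀ {n} {I J : Subset (suc n)} {e} → IsEdge (barSet J) (barSet I) e → IsEdge I J (flipEdge e)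
IsEdge-flip⁻ {e = b , w} (b∈J̄ , w∈Ī , b<w) = ∈barSet⁻ w∈Ī , ∈barSet⁻ b∈J̄ , opposite-edge-index b<w

module _ {n' : ℕ} {ε ε' : Signature (suc n')} (P : Polygon (suc n') ε) (P' : Polygon (suc n') ε')
         {I J I' J' : Subset (suc (suc n'))} where
  open Ranks n' using (flipVertex)

  open Polygon P' renaming (black to black'; white to white')

  reversed⇒flipReversing : ReversedOrientations (position P) (position P') →
    (∀ {e} → IsEdge I J e → IsEdge I' J' e) → FlipReversing P I J P' I' J' (λ e → e)
  reversed⇒flipReversing rev edge = record
    { edge  = edge
    ; cross = λ { {b , w} {b' , w'} e≢e' c →
        crossing⇒segCross (black' b) (white' w) (black' b') (white' w')
          (crossing-reversed {p = position P} {q = position P'} rev (inj₁ b) (inj₂ w) (inj₁ b') (inj₂ w')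
            (crosses⇒crossing P e≢e' c)) }
    ; slope = λ { {b , w} {b' , w'} e≢e' c →
        leftTurn-reversed {p = position P} {q = position P'} rev (inj₁ b) (inj₂ w) (inj₁ b') (inj₂ w')
          (proj₁ (crosses⇒crossing P e≢e' c)) }
    }

  flipped⇒flipReversing : ReversedOrientations (position P) (λ v → position P' (flipVertex v)) →
    (∀ {e} → IsEdge I J e → IsEdge I' J' (flipEdge e)) → FlipReversing P I J P' I' J' flipEdge
  flipped⇒flipReversing rev edge = record
    { edge  = edge
    ; cross = λ { {b , w} {b' , w'} e≢e' c →
        crossing⇒segCross (black' (opposite w)) (white' (opposite b)) (black' (opposite w')) (white' (opposite b'))
          (Crossing-reverse {white' (opposite b)} {black' (opposite w)} {white' (opposite b')} {black' (opposite w')}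
            (crossing-reversed {p = position P} {q = λ v → position P' (flipVertex v)} rev
              (inj₁ b) (inj₂ w) (inj₁ b') (inj₂ w') (crosses⇒crossing P e≢e' c))) }
    ; slope = λ { {b , w} {b' , w'} e≢e' c turn →
        LeftTurn-reverse {white' (opposite b')} {black' (opposite w')} {white' (opposite b)} {black' (opposite w)}
          (leftTurn-reversed {p = position P} {q = λ v → position P' (flipVertex v)} rev
            (inj₁ b) (inj₂ w) (inj₁ b') (inj₂ w') (proj₁ (crosses⇒crossing P e≢e' c)) turn) }
    }

lemma2p2 : (n : ℕ) → 1 ℕ.≤ n → (ε : Signature n) → (I J : Subset (suc n)) →
           Nonempty I → Nonempty J → MinLess I J → MaxLess I J →
           (P : Polygon n ε) → (Pneg : Polygon n (negSig ε)) → (Pbar : Polygon n (barSig ε)) →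
           DiIso (IncFlipGraph Pneg I J) (opG (IncFlipGraph P I J))
           × DiIso (IncFlipGraph Pbar (barSet J) (barSet I)) (opG (IncFlipGraph P I J))
lemma2p2 (suc n') _ ε I J _ _ _ _ P Pneg Pbar =
  relabel-antiIso (λ e → e) (λ _ → refl)
    (reversed⇒flipReversing Pneg P (ReversedOrientations-sym {p = position P} {q = position Pneg} negRev) (λ e → e))
    (reversed⇒flipReversing P Pneg negRev (λ e → e)) ,
  relabel-antiIso flipEdge flipEdge-involutive
    (flipped⇒flipReversing Pbar P
      (ReversedOrientations-involution {p = position P} {q = position Pbar} flipVertex flipVertex-involutive barRev)
      IsEdge-flip⁻)
    (flipped⇒flipReversing P Pbar barRev IsEdge-flip)
  where
  open Ranks n' using (flipVertex; flipVertex-involutive)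
  negRev = negated-polygons-reversed P Pneg
  barRev = flipped-polygons-reversed P Pbar
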